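{- Let $n\geq 2$ be prime. Let $\mathcal{C}$ be the SCD of the necklace poset $N_n$ obtained from the Griggs–Killian–Savage construction (i.e., the chains of necklaces $(\langle x\rangle)$ for $x$ running along each chain of $D^{\mathrm{GKS}}_n$), and let $\overline{\mathcal{C}}$ be its complement. Then $\mathcal{C}$ and $\overline{\mathcal{C}}$ can each be unrolled (by suitable choices of necklace representatives) so that the two resulting SCDs of $Q_n$ are almost-orthogonal.
   Context: Identify subsets of $[n]$ with bitstrings $x=x_1\cdots x_n\in\{0,1\}^n$; $Q_n$ is the cube ordered by inclusion; $\sigma$ is the cyclic right rotation $\sigma(x_1\cdots x_n)=x_nx_1\cdots x_{n-1}$ (renaming $i\mapsto i+1$ mod $n$); $\overline{x}$ is the bitwise complement. The necklace of $x$ is $\langle x\rangle=\{\sigma^i(x):i\geq 0\}$; it is full if it has $n$ elements and deficient otherwise. The necklace poset $N_n$ has the necklaces as elements, with cover relations $(\langle x\rangle,\langle y\rangle)$ whenever $x\subseteq y$ is a cover relation in $Q_n$; it inherits levels from $Q_n$, and symmetric saturated chains and SCDs of $N_n$ are defined as in $Q_n$ (chains from level $k$ to level $n-k$ with one element per intermediate level, partitioning $N_n$). The complement of an SCD of $N_n$ replaces every necklace $\langle x\rangle$ by $\langle\overline{x}\rangle$. A chain of $N_n$ is unimodal if its minimal and maximal necklaces have the same size and all others are full. Unrolling: given a unimodal chain $(y_0,\dots,y_{m})$ of $N_n$ whose end necklaces have size $d$, choose representatives $x_i\in y_i$ forming a chain in $Q_n$; the unrolled chains are $\sigma^i(x_0,\dots,x_m)$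 for $0\le i<d$ and $\sigma^i(x_1,\dots,x_{m-1})$ for $d\le i<n$ (when $d=n$ only the first kind occurs); unrolling every chain of a unimodal SCD of $N_n$ yields an SCD of $Q_n$. An SCD of $Q_n$ is a partition into $\binom{n}{\lfloor n/2\rfloor}$ symmetric saturated chains; two SCDs are almost-orthogonal if any chain of one and any chain of the other share at most one element, except that the two chains of size $n+1$ may share exactly $0^n$ and $1^n$. Greene–Kleitman SCD $D_n$: read each 0 as an opening and each 1 as a closing parenthesis and match them in the usual way; $M(x)$ is the set of matched index pairs, $U_0(x)$, $U_1(x)$ the sets of indices of unmatched 0s and 1s. If $U_0(x)\neq\emptyset$, $\tau(x)$ flips the leftmost unmatched 0 to 1. $D_n$ consists of the chains $(x,\tau(x),\dots,\tau^{k}(x))$ for all $x$ with $U_1(x)=\emptyset$, $k=|U_0(x)|$. Block code: if $x=1^{a_1}0^{b_1}\cdots1^{a_r}0^{b_r}$ with $r\ge1$, all $a_i,b_i\ge1$, then $\beta(x)=(a_1+b_1,\dots,a_r+b_r)$; otherwise $\beta(x)=(\infty)$. For prime $n$, $R^{\mathrm{GKS}}_n$ is the set of bitstrings whose block code is lexicographically minimal within their necklace (exactly one per necklace), and $D^{\mathrm{GKS}}_n$ is the family of subchains of chains of $D_n$ formed by the elements of $R^{\mathrm{GKS}}_n$; these are symmetric saturated and their necklaces form an SCD of $N_n$. -}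

module Defs where

open import Data.Bool using (Bool; true; false; _∧_; _∨_; not)
open import Data.Bool.Properties using () renaming (_≟_ to _≟B_)
open import Data.Nat using (ℕ; zero; suc; _<_; _≤_; _+_; _∸_; _<ᵇ_; _≡ᵇ_)
open import Data.Fin using (Fin)
open import Data.Vec as V using (Vec; []; _∷_; lookup; _[_]≔_; replicate; toList)
open import Data.Vec.Properties using (≡-dec)
open import Data.List as L using (List; []; _∷_; length; upTo; filterᵇ; deduplicate; reverse; drop; take)
open import Data.List.Relation.Unary.Linked using (Linked)
open import Data.List.Relation.Binary.Pointwise using (Pointwise)
open import Data.List.Membership.Propositional using (_∈_)
open import Data.Maybe using (Maybe; just; nothing)
open import Data.Product using (Σ; _×_; _,_; proj₁; proj₂)
open import Data.Sum using (_⊎_)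
open import Data.Empty using (⊥)
open import Relation.Binary.PropositionalEquality using (_≡_; _≢_)

-- Bitstrings of length n; false = 0, true = 1 (x_i = 1 iff i ∈ subset).
Bits : ℕ → Set
Bits n = Vec Bool n

zeros ones : ∀ {n} → Bits n
zeros = replicate _ false
ones  = replicate _ true

compl : ∀ {n} → Bits n → Bits n
compl = V.map not

σ : ∀ {n} → Bits n → Bits n
σ {zero}  []  = []
σ {suc m} xs  = V.last xs ∷ V.init xs

rot : ∀ {n} → ℕ → Bits n → Bits n
rot zero    x = x
rot (suc i) x = σ (rot i x)

InNecklace : ∀ {n} → Bits n → Bits n → Set
InNecklace x y = Σ ℕ λ i → rot i x ≡ y

neckSize : ∀ {n} → Bits n → ℕ
neckSize {n} x = length (deduplicate (≡-dec _≟B_) (L.map (λ i → rot i x) (upTo n)))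

Cover : ∀ {n} → Bits n → Bits n → Set
Cover {n} x y = Σ (Fin n) λ i → lookup x i ≡ false × y ≡ x [ i ]≔ true

IsQChain : ∀ {n} → List (Bits n) → Set
IsQChain = Linked Cover

-- Parenthesis matching scan (0 = '(' , 1 = ')').  Arguments: remaining
-- bits, current index, stack of indices of currently unmatched 0s (top =
-- rightmost), indices of unmatched 1s.
scan : List Bool → ℕ → List ℕ → List ℕ → List ℕ × List ℕ
scan []            i st       u1 = st , u1
scan (false ∷ xs)  i st       u1 = scan xs (suc i) (i ∷ st) u1
scan (true ∷ xs)   i []       u1 = scan xs (suc i) [] (i ∷ u1)
scan (true ∷ xs)   i (_ ∷ st) u1 = scan xs (suc i) st u1

-- U₀(x) (in increasing order) and U₁(x), indices counted from 0
U₀ : ∀ {n} → Bits n → List ℕ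
U₀ x = reverse (proj₁ (scan (toList x) 0 [] []))

U₁ : ∀ {n} → Bits n → List ℕ
U₁ x = proj₂ (scan (toList x) 0 [] [])

setOne : ∀ {n} → Bits n → ℕ → Bits n
setOne []       _       = []
setOne (b ∷ xs) zero    = true ∷ xs
setOne (b ∷ xs) (suc i) = b ∷ setOne xs i

τ : ∀ {n} → Bits n → Bits n
τ x with U₀ x
... | []    = x
... | i ∷ _ = setOne x i

τ^ : ∀ {n} → ℕ → Bits n → Bits n
τ^ zero    x = x
τ^ (suc j) x = τ (τ^ j x)

gkChain : ∀ {n} → Bits n → List (Bits n)
gkChain x = L.map (λ j → τ^ j x) (upTo (suc (length (U₀ x))))

-- block lengths of a list 1^{a₁}0^{b₁}⋯1^{a_r}0^{b_r}; arguments: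
-- remaining bits, length of current block so far, previous bit
blocksGo : List Bool → ℕ → Bool → List ℕ
blocksGo []           acc prev  = acc ∷ []
blocksGo (true ∷ xs)  acc false = acc ∷ blocksGo xs 1 true
blocksGo (true ∷ xs)  acc true  = blocksGo xs (suc acc) true
blocksGo (false ∷ xs) acc _     = blocksGo xs (suc acc) false

startsWith1 : List Bool → Bool
startsWith1 (true ∷ _) = true
startsWith1 _          = false

endsWith0 : List Bool → Bool
endsWith0 xs with L.last xs
... | just false = true
... | _          = false

-- β(x) ; nothing encodes the code (∞)
β : ∀ {n} → Bits n → Maybe (List ℕ)
β x with toList x
... | [] = nothing
... | b ∷ bs with startsWith1 (b ∷ bs) ∧ endsWith0 (b ∷ bs)
...   | true  = just (blocksGo bs 1 b)
...   | false = nothing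

lexLeq : List ℕ → List ℕ → Bool
lexLeq []       _        = true
lexLeq (_ ∷ _)  []       = false
lexLeq (a ∷ as) (b ∷ bs) = (a <ᵇ b) ∨ ((a ≡ᵇ b) ∧ lexLeq as bs)

codeLeq : Maybe (List ℕ) → Maybe (List ℕ) → Bool
codeLeq (just a) (just b) = lexLeq a b
codeLeq (just _) nothing  = true
codeLeq nothing  nothing  = true
codeLeq nothing  (just _) = false

allB : {A : Set} → (A → Bool) → List A → Bool
allB p []       = true
allB p (a ∷ as) = p a ∧ allB p as

isGKSRep : ∀ {n} → Bits n → Bool
isGKSRep {n} x = allB (λ i → codeLeq (β x) (β (rot i x))) (upTo n)

-- c is a chain of D^GKS_n : the (nonempty) subchain of a chain of D_n
-- formed by its elements lying in R^GKS_n
GKSChain : (n : ℕ) → List (Bits n) → Set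
GKSChain n c = Σ (Bits n) λ x → U₁ x ≡ [] × c ≡ filterᵇ isGKSRep (gkChain x) × c ≢ []

RepChoice : ∀ {n} → List (Bits n) → List (Bits n) → Set
RepChoice ys xs = Pointwise InNecklace ys xs × IsQChain xs

inner : ∀ {n} → List (Bits n) → List (Bits n)
inner xs = drop 1 (take (length xs ∸ 1) xs)

Unrolled : ∀ {n} → List (Bits n) → List (Bits n) → Set
Unrolled         []       z = ⊥
Unrolled {n} (x ∷ xs) z =
  (Σ ℕ λ i → i < neckSize x × z ≡ L.map (rot i) (x ∷ xs))
  ⊎ (Σ ℕ λ i → neckSize x ≤ i × i < n × z ≡ L.map (rot i) (inner (x ∷ xs)))

AlmostOrthogonal : (n : ℕ) → (List (Bits n) → Set) → (List (Bits n) → Set) → Set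
AlmostOrthogonal n F G =
  ∀ z w → F z → G w →
    (∀ a b → a ∈ z → a ∈ w → b ∈ z → b ∈ w → a ≡ b)
    ⊎ (length z ≡ suc n × length w ≡ suc n ×
       (∀ a → a ∈ z → a ∈ w → a ≡ zeros ⊎ a ≡ ones))

-- the necklace chain of the complement of a chain: ⟨x̄⟩ for x ∈ c,
-- listed bottom to top
complChain : ∀ {n} → List (Bits n) → List (Bits n)
complChain c = reverse (L.map compl c)

-- GKS chains are chains of Q_n: a nonconstant representative starts with 1 and
-- ends with 0, and τ either sets a 0 lying between a 1 and a 0, which changes no
-- block code of any rotation, or sets the last bit, after which no word ends in 0.
-- So every chain serves as its own representatives, and the reversed complemented
-- chain as those of its complement.
--
-- Up to one rotation each, an unrolled chain consists of words τ^s x of one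
-- Greene–Kleitman chain, and an unrolled complemented chain of complements of
-- words τ^s x′ of another.  Let a ⊂ b be shared.  If the complemented chain lists
-- them in the other order, also a ⊃ b.  Otherwise τ, on its way from the x′-word
-- of b to that of a, sets a bit g; τ only sets 0s following a 1, so b has a 0
-- before g.  But g also changes on the way from a to b along x, where τ sets it
-- after a 1 of b.  As representatives start with 1, "before" never wraps around,
-- unless a = 0ⁿ or b = 1ⁿ, which only the chain 0ⁿ ⊂ 10ⁿ⁻¹ ⊂ ⋯ ⊂ 1ⁿ and its
-- complement contain.

module Submission where

open import Defs
open import Data.Nat using (ℕ)
open import Data.Nat.Primality using (Prime)
open import Data.List using (List)
open import Data.Product using (Σ; _×_)

open import Data.Bool using (Bool; true; false; not; _∧_; _∨_; if_then_else_)
open import Data.Bool.Properties using (¬-not; ∨-zeroʳ; T?; T-≡) renaming (_≟_ to _≟ᵇ_)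
open import Data.Empty using (⊥-elim)
open import Data.Fin using (Fin; toℕ; fromℕ<)
open import Data.Fin.Properties using (toℕ-fromℕ<)
open import Data.List as L using ([]; _∷_; _∷ʳ_; _++_; length; reverse; applyUpTo; filterᵇ; upTo; take; drop; deduplicate)
open import Data.List.Membership.Propositional using (_∈_; _∉_)
open import Data.List.Membership.Propositional.Properties using (∈-map⁻; ∈-applyUpTo⁻; ∈-filter⁻; ∈-upTo⁺)
open import Data.List.Properties using (length-++; length-applyUpTo; length-map; length-reverse; map-id; map-++; map-upTo; reverse-++; unfold-reverse; applyUpTo-∷ʳ; filter-reject)
import Data.List.Properties as Listₚ
import Data.List.Relation.Binary.Pointwise as Pointwise
open import Data.List.Relation.Unary.All as All using (All; []; _∷_)
open import Data.List.Relation.Unary.Any using (here; there)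
open import Data.List.Relation.Unary.Any.Properties using (reverse⁻)
open import Data.List.Relation.Unary.Linked as Linked using (Linked; []; [-]; _∷_)
open import Data.List.Relation.Unary.Linked.Properties using (map⁺; applyUpTo⁺₁)
open import Data.Maybe using (just; nothing)
open import Data.Nat
open import Data.Nat.DivMod
open import Data.Nat.Primality using (¬prime[0]; ¬prime[1])
open import Data.Nat.Properties
open import Data.Nat.Tactic.RingSolver using (solve-∀)
open import Data.Product using (∃; ∃₂; _,_; proj₁; proj₂)
open import Data.Sum as Sum using (_⊎_; inj₁; inj₂)
open import Data.Unit using (⊤; tt)
open import Data.Vec as V using ([]; _∷_; toList; lookup; _[_]≔_)
open import Data.Vec.Properties using (length-toList; map-[]≔; lookup-map; lookup∘update; []≔-idempotent; []≔-lookup; map-replicate)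
import Data.Vec.Properties as Vecₚ
open import Function using (_∘_; flip; id; Equivalence)
open import Relation.Binary.Definitions using (Tri; tri<; tri≈; tri>)
open import Relation.Binary.PropositionalEquality
open import Relation.Nullary using (¬_; Dec; yes; no; ¬?)
open import Relation.Nullary.Decidable using (_×-dec_)

true≢false : true ≢ false
true≢false ()

-- Out-of-range bits read as 0.
bitᴸ : List Bool → ℕ → Bool
bitᴸ []       _       = false
bitᴸ (b ∷ _)  zero    = b
bitᴸ (_ ∷ bs) (suc i) = bitᴸ bs i

bit : ∀ {n} → Bits n → ℕ → Bool
bit y = bitᴸ (toList y)

bit-ext : ∀ {n} (a b : Bits n) → (∀ i → i < n → bit a i ≡ bit b i) → a ≡ b
bit-ext []      []      _ = refl
bit-ext (x ∷ a) (y ∷ b) h = cong₂ _∷_ (h 0 z<s) (bit-ext a b (λ i i<n → h (suc i) (s<s i<n)))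

bit-true⇒< : ∀ {n} (y : Bits n) {k} → bit y k ≡ true → k < n
bit-true⇒< (_ ∷ _) {zero}  _ = z<s
bit-true⇒< (_ ∷ y) {suc k} e = s<s (bit-true⇒< y e)

bit-setOne-same : ∀ {n} (y : Bits n) {i} → i < n → bit (setOne y i) i ≡ true
bit-setOne-same (_ ∷ _) {zero}  _       = refl
bit-setOne-same (_ ∷ y) {suc i} (s<s p) = bit-setOne-same y p

bit-setOne-other : ∀ {n} (y : Bits n) {i k} → i ≢ k → bit (setOne y i) k ≡ bit y k
bit-setOne-other []      {_}     {_}     _  = refl
bit-setOne-other (_ ∷ _) {zero}  {zero}  ne = ⊥-elim (ne refl)
bit-setOne-other (_ ∷ _) {zero}  {suc k} _  = refl
bit-setOne-other (_ ∷ _) {suc i} {zero}  _  = refl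
bit-setOne-other (_ ∷ y) {suc i} {suc k} ne = bit-setOne-other y (ne ∘ cong suc)

bit-setOne-true : ∀ {n} (y : Bits n) i {k} → bit y k ≡ true → bit (setOne y i) k ≡ true
bit-setOne-true y i {k} e with i ≟ k
... | yes refl = bit-setOne-same y (bit-true⇒< y e)
... | no i≢k   = trans (bit-setOne-other y i≢k) e

bit-compl : ∀ {n} (y : Bits n) {k} → k < n → bit (compl y) k ≡ not (bit y k)
bit-compl (_ ∷ _) {zero}  _       = refl
bit-compl (_ ∷ y) {suc k} (s<s p) = bit-compl y p

bit-zeros : ∀ {n} k → bit (zeros {n}) k ≡ false
bit-zeros {zero}  _       = refl
bit-zeros {suc n} zero    = refl
bit-zeros {suc n} (suc k) = bit-zeros {n} k

bit-ones : ∀ {n} {k} → k < n → bit (ones {n}) k ≡ true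
bit-ones {suc n} {zero}  _       = refl
bit-ones {suc n} {suc k} (s<s p) = bit-ones {n} p

bit-init : ∀ {m} (y : Bits (suc m)) {k} → k < m → bit (V.init y) k ≡ bit y k
bit-init (_ ∷ _ ∷ _) {zero}  _       = refl
bit-init (_ ∷ y)     {suc k} (s<s p) = bit-init y p

bit-last : ∀ {m} (y : Bits (suc m)) → V.last y ≡ bit y m
bit-last (_ ∷ [])    = refl
bit-last (_ ∷ _ ∷ y) = bit-last (_ ∷ y)

zeros⊎has-1 : ∀ {n} (x : Bits n) → x ≡ zeros ⊎ ∃ λ a → bit x a ≡ true
zeros⊎has-1 []          = inj₁ refl
zeros⊎has-1 (true ∷ _)  = inj₂ (0 , refl)
zeros⊎has-1 (false ∷ x) with zeros⊎has-1 x
... | inj₁ refl       = inj₁ refl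
... | inj₂ (a , bₐ)   = inj₂ (suc a , bₐ)

rising-edge : ∀ {n} (x : Bits n) {a} → bit x 0 ≡ false → bit x a ≡ true →
              ∃ λ d → bit x d ≡ false × bit x (suc d) ≡ true
rising-edge x {zero}  b₀ bₐ = ⊥-elim (true≢false (trans (sym bₐ) b₀))
rising-edge x {suc a} b₀ bₐ with bit x a in e
... | true  = rising-edge x b₀ e
... | false = a , e , bₐ

-- Parenthesis matching and τ

OnHead : (ℕ → Set) → List ℕ → Set
OnHead P []      = ⊤
OnHead P (g ∷ _) = P g

OnHead-∷ʳ⁻ : ∀ {P} xs {x} → OnHead P (xs ∷ʳ x) → OnHead P xs
OnHead-∷ʳ⁻ []      _ = tt
OnHead-∷ʳ⁻ (_ ∷ _) p = p

OnHead-∷ʳ⁺ : ∀ {P} xs {x y} → OnHead P (xs ∷ʳ x) → OnHead P (xs ∷ʳ x ∷ʳ y)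
OnHead-∷ʳ⁺ []      p = p
OnHead-∷ʳ⁺ (_ ∷ _) p = p

-- Invariant of the matching scan after reading the first i bits of ys;
-- the stack holds the unmatched 0s read so far, most recent on top.
module _ (ys : List Bool) where

  Unmatched0 : ℕ → ℕ → Set
  Unmatched0 i g = g < i × bitᴸ ys g ≡ false × (suc g < i → bitᴸ ys (suc g) ≡ false)

  Preceded1 : ℕ → Set
  Preceded1 g = g ≡ 0 ⊎ bitᴸ ys (pred g) ≡ true

  record ScanInv (i : ℕ) (st : List ℕ) : Set where
    field
      empty     : st ≡ [] → Preceded1 i
      unmatched : All (Unmatched0 i) st
      sorted    : Linked _>_ st
      bottom    : OnHead Preceded1 (reverse st)
  open ScanInv

  scanInv-start : ScanInv 0 []
  scanInv-start = record { empty = λ _ → inj₁ refl ; unmatched = [] ; sorted = [] ; bottom = tt }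

  private
    push : ∀ {i st} → bitᴸ ys i ≡ false → ScanInv i st → ScanInv (suc i) (i ∷ st)
    push {i} {st} bᵢ inv = record
      { empty     = λ ()
      ; unmatched = (n<1+n i , bᵢ , λ 1+i<1+i → ⊥-elim (<-irrefl refl (≤-pred 1+i<1+i)))
                    ∷ All.map widen (unmatched inv)
      ; sorted    = sorted-push st (unmatched inv) (sorted inv)
      ; bottom    = bottom-push st (empty inv) (bottom inv)
      }
      where
      widen : ∀ {g} → Unmatched0 i g → Unmatched0 (suc i) g
      widen {g} (g<i , b₉ , next) = m<n⇒m<1+n g<i , b₉ , next′
        where
        next′ : suc g < suc i → bitᴸ ys (suc g) ≡ false
        next′ 1+g<1+i with m≤n⇒m<n∨m≡n (≤-pred 1+g<1+i)
        ... | inj₁ 1+g<i  = next 1+g<i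
        ... | inj₂ refl   = bᵢ
      sorted-push : ∀ s → All (Unmatched0 i) s → Linked _>_ s → Linked _>_ (i ∷ s)
      sorted-push []      _                 _ = [-]
      sorted-push (_ ∷ _) ((h<i , _) ∷ _) l = h<i ∷ l
      bottom-push : ∀ s → (s ≡ [] → Preceded1 i) → OnHead Preceded1 (reverse s) →
                    OnHead Preceded1 (reverse (i ∷ s))
      bottom-push []       e _ = e refl
      bottom-push (h ∷ hs) _ b =
        subst (OnHead Preceded1) (sym (unfold-reverse i (h ∷ hs)))
          (subst (λ r → OnHead Preceded1 (r ∷ʳ i)) (sym (unfold-reverse h hs))
            (OnHead-∷ʳ⁺ (reverse hs) (subst (OnHead Preceded1) (unfold-reverse h hs) b)))

    pop : ∀ {i t st} → bitᴸ ys i ≡ true → ScanInv i (t ∷ st) → ScanInv (suc i) st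
    pop {i} {t} {st} bᵢ inv = record
      { empty     = λ _ → inj₂ bᵢ
      ; unmatched = All.zipWith (λ (g<t , u) → narrow g<t u) (below-top (sorted inv) , All.tail (unmatched inv))
      ; sorted    = tail-sorted (sorted inv)
      ; bottom    = OnHead-∷ʳ⁻ (reverse st) (subst (OnHead Preceded1) (unfold-reverse t st) (bottom inv))
      }
      where
      t<i : t < i
      t<i = proj₁ (All.head (unmatched inv))
      narrow : ∀ {g} → g < t → Unmatched0 i g → Unmatched0 (suc i) g
      narrow g<t (g<i , b₉ , next) = m<n⇒m<1+n g<i , b₉ , λ _ → next (≤-<-trans g<t t<i)
      below-top : ∀ {t s} → Linked _>_ (t ∷ s) → All (_< t) s
      below-top [-]     = []
      below-top (h ∷ l) = h ∷ All.map (λ g<h → <-trans g<h h) (below-top l)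
      tail-sorted : ∀ {t s} → Linked _>_ (t ∷ s) → Linked _>_ s
      tail-sorted [-]     = []
      tail-sorted (_ ∷ l) = l

    skip : ∀ {i} → bitᴸ ys i ≡ true → ScanInv i [] → ScanInv (suc i) []
    skip bᵢ _ = record { empty = λ _ → inj₂ bᵢ ; unmatched = [] ; sorted = [] ; bottom = tt }

  SuffixAt : ℕ → List Bool → Set
  SuffixAt i xs = ∀ k → bitᴸ xs k ≡ bitᴸ ys (i + k)

  private
    suffix-head : ∀ {i b xs} → SuffixAt i (b ∷ xs) → bitᴸ ys i ≡ b
    suffix-head {i} sfx = sym (trans (sfx 0) (cong (bitᴸ ys) (+-identityʳ i)))

    suffix-tail : ∀ {i b xs} → SuffixAt i (b ∷ xs) → SuffixAt (suc i) xs
    suffix-tail {i} sfx k = trans (sfx (suc k)) (cong (bitᴸ ys) (+-suc i k))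

  scanInv : ∀ xs i st u1 → SuffixAt i xs → ScanInv i st →
            ScanInv (i + length xs) (proj₁ (scan xs i st u1))
  scanInv []           i st       u1 _   inv rewrite +-identityʳ i = inv
  scanInv (false ∷ xs) i st       u1 sfx inv rewrite +-suc i (length xs) =
    scanInv xs (suc i) (i ∷ st) u1 (suffix-tail sfx) (push (suffix-head sfx) inv)
  scanInv (true ∷ xs)  i []       u1 sfx inv rewrite +-suc i (length xs) =
    scanInv xs (suc i) [] (i ∷ u1) (suffix-tail sfx) (skip (suffix-head sfx) inv)
  scanInv (true ∷ xs)  i (_ ∷ st) u1 sfx inv rewrite +-suc i (length xs) =
    scanInv xs (suc i) st u1 (suffix-tail sfx) (pop (suffix-head sfx) inv)

record LeftmostUnmatched0 {n} (y : Bits n) (g : ℕ) : Set where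
  field
    g<n      : g < n
    bit≡0    : bit y g ≡ false
    preceded : g ≡ 0 ⊎ bit y (pred g) ≡ true
    followed : suc g < n → bit y (suc g) ≡ false

private
  scanInv-final : ∀ {n} (y : Bits n) → ScanInv (toList y) (length (toList y)) (proj₁ (scan (toList y) 0 [] []))
  scanInv-final y = scanInv (toList y) (toList y) 0 [] [] (λ _ → refl) (scanInv-start (toList y))

leftmostUnmatched0 : ∀ {n} (y : Bits n) {g gs} → U₀ y ≡ g ∷ gs → LeftmostUnmatched0 y g
leftmostUnmatched0 y {g} eq = record
  { g<n      = subst (g <_) (length-toList y) (proj₁ unmatched-g)
  ; bit≡0    = proj₁ (proj₂ unmatched-g)
  ; preceded = subst (OnHead (Preceded1 (toList y))) eq (ScanInv.bottom (scanInv-final y))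
  ; followed = λ 1+g<n → proj₂ (proj₂ unmatched-g) (subst (suc g <_) (sym (length-toList y)) 1+g<n)
  }
  where
  unmatched-g : Unmatched0 (toList y) (length (toList y)) g
  unmatched-g = All.lookup (ScanInv.unmatched (scanInv-final y)) (reverse⁻ (subst (g ∈_) (sym eq) (here refl)))

private
  reverse-≡[] : ∀ {xs : List ℕ} → reverse xs ≡ [] → xs ≡ []
  reverse-≡[] {[]}    _ = refl
  reverse-≡[] {x ∷ xs} e with () ← trans (sym (length-reverse (x ∷ xs))) (cong length e)

last-0⇒unmatched-0 : ∀ {m} (y : Bits (suc m)) → bit y m ≡ false → ∃₂ λ g gs → U₀ y ≡ g ∷ gs
last-0⇒unmatched-0 {m} y@(_ ∷ _) bₘ with U₀ y in eq
... | g ∷ gs = g , gs , refl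
... | []     with ScanInv.empty (scanInv-final y) (reverse-≡[] eq)
...   | inj₂ b = ⊥-elim (true≢false (trans (sym b) (trans (cong (λ k → bit y (pred k)) (length-toList y)) bₘ)))

private
  scan-u1-nonempty : ∀ xs i st u1 → u1 ≢ [] → proj₂ (scan xs i st u1) ≢ []
  scan-u1-nonempty []           i st       u1 ne = ne
  scan-u1-nonempty (false ∷ xs) i st       u1 ne = scan-u1-nonempty xs (suc i) (i ∷ st) u1 ne
  scan-u1-nonempty (true ∷ xs)  i []       u1 _  = scan-u1-nonempty xs (suc i) [] (i ∷ u1) λ ()
  scan-u1-nonempty (true ∷ xs)  i (_ ∷ st) u1 ne = scan-u1-nonempty xs (suc i) st u1 ne

U₁≡[]⇒first-0 : ∀ {m} (y : Bits (suc m)) → U₁ y ≡ [] → bit y 0 ≡ false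
U₁≡[]⇒first-0 (false ∷ _) _  = refl
U₁≡[]⇒first-0 (true ∷ y)  eq = ⊥-elim (scan-u1-nonempty (toList y) 1 [] (0 ∷ []) (λ ()) eq)

length-U₀-zeros : ∀ n → length (U₀ (zeros {n})) ≡ n
length-U₀-zeros n = trans (length-reverse (proj₁ (scan (toList (zeros {n})) 0 [] [])))
                      (trans (go n 0 [] []) (+-identityʳ n))
  where
  go : ∀ n i st u1 → length (proj₁ (scan (toList (zeros {n})) i st u1)) ≡ n + length st
  go zero    i st u1 = refl
  go (suc n) i st u1 = trans (go n (suc i) (i ∷ st) u1) (+-suc n (length st))

τ-fixed : ∀ {n} (y : Bits n) → U₀ y ≡ [] → τ y ≡ y
τ-fixed y eq rewrite eq = refl

τ-flips : ∀ {n} (y : Bits n) {g gs} → U₀ y ≡ g ∷ gs → τ y ≡ setOne y g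
τ-flips y eq rewrite eq = refl

τ-monotone : ∀ {n} (y : Bits n) {k} → bit y k ≡ true → bit (τ y) k ≡ true
τ-monotone y e with U₀ y
... | []    = e
... | g ∷ _ = bit-setOne-true y g e

τ^-monotone : ∀ {n} j (y : Bits n) {k} → bit y k ≡ true → bit (τ^ j y) k ≡ true
τ^-monotone zero    y e = e
τ^-monotone (suc j) y e = τ-monotone (τ^ j y) (τ^-monotone j y e)

τ^-+ : ∀ {n} a b (y : Bits n) → τ^ (a + b) y ≡ τ^ a (τ^ b y)
τ^-+ zero    b y = refl
τ^-+ (suc a) b y = cong τ (τ^-+ a b y)

τ^-comm-τ : ∀ {n} j (y : Bits n) → τ^ j (τ y) ≡ τ (τ^ j y)
τ^-comm-τ j y = trans (sym (τ^-+ j 1 y)) (cong (λ k → τ^ k y) (+-comm j 1))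

τ^-fixed : ∀ {n} j (y : Bits n) → U₀ y ≡ [] → τ^ j y ≡ y
τ^-fixed zero    y _  = refl
τ^-fixed (suc j) y eq = trans (cong τ (τ^-fixed j y eq)) (τ-fixed y eq)

τ-sets-leftmostUnmatched0 : ∀ {n} (y : Bits n) {g gs} → U₀ y ≡ g ∷ gs → bit (τ y) g ≡ true
τ-sets-leftmostUnmatched0 y {g} eq =
  subst (λ z → bit z g ≡ true) (sym (τ-flips y eq))
    (bit-setOne-same y (LeftmostUnmatched0.g<n (leftmostUnmatched0 y eq)))

τ^-sets-leftmostUnmatched0 : ∀ {n} j (y : Bits n) {g gs} → U₀ y ≡ g ∷ gs → bit (τ^ (suc j) y) g ≡ true
τ^-sets-leftmostUnmatched0 j y {g} eq =
  subst (λ z → bit z g ≡ true) (τ^-comm-τ j y) (τ^-monotone j (τ y) (τ-sets-leftmostUnmatched0 y eq))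

τ-newly-set : ∀ {n} (y : Bits n) {d} → bit y d ≡ false → bit (τ y) d ≡ true → ∃ λ gs → U₀ y ≡ d ∷ gs
τ-newly-set y {d} b₀ b₁ with U₀ y
... | [] = ⊥-elim (true≢false (trans (sym b₁) b₀))
... | g ∷ gs with g ≟ d
...   | yes refl = gs , refl
...   | no g≢d   = ⊥-elim (true≢false (trans (sym b₁) (trans (bit-setOne-other y g≢d) b₀)))

τ^-newly-set-follows-1 : ∀ {n} j (y : Bits n) {d} → bit y d ≡ false → bit (τ^ j y) d ≡ true →
                         d ≡ 0 ⊎ bit (τ^ j y) (pred d) ≡ true
τ^-newly-set-follows-1 zero    y b₀ b₁ = ⊥-elim (true≢false (trans (sym b₁) b₀))
τ^-newly-set-follows-1 (suc j) y {d} b₀ b₁ with bit (τ^ j y) d in e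
... | true  = Sum.map₂ (τ-monotone (τ^ j y)) (τ^-newly-set-follows-1 j y b₀ e)
... | false = Sum.map₂ (τ-monotone (τ^ j y))
                (LeftmostUnmatched0.preceded (leftmostUnmatched0 (τ^ j y) (proj₂ (τ-newly-set (τ^ j y) e b₁))))

-- τ only sets a 0 whose right neighbour is 0, so a 0 followed by a 1 is never set.
τ^-keeps-0-before-1 : ∀ {n} j (y : Bits n) {d} → bit y d ≡ false → bit y (suc d) ≡ true →
                      bit (τ^ j y) d ≡ false
τ^-keeps-0-before-1 zero    y b₀ _  = b₀
τ^-keeps-0-before-1 (suc j) y {d} b₀ b₁ with bit (τ^ (suc j) y) d in e
... | false = refl
... | true with τ-newly-set (τ^ j y) (τ^-keeps-0-before-1 j y b₀ b₁) e
...   | _ , eq = ⊥-elim (true≢false (trans (sym b₁′) (followed (bit-true⇒< (τ^ j y) b₁′))))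
  where
  open LeftmostUnmatched0 (leftmostUnmatched0 (τ^ j y) eq)
  b₁′ = τ^-monotone j y b₁

leftmostUnmatched0-after-1 : ∀ {n} {y : Bits n} {g} → bit y 0 ≡ true → LeftmostUnmatched0 y g →
             ∃ λ g₀ → g ≡ suc g₀ × bit y g₀ ≡ true
leftmostUnmatched0-after-1 {g = zero}   b₀ lu = ⊥-elim (true≢false (trans (sym b₀) (LeftmostUnmatched0.bit≡0 lu)))
leftmostUnmatched0-after-1 {g = suc g₀} b₀ lu with LeftmostUnmatched0.preceded lu
... | inj₂ bₚ = g₀ , refl , bₚ

τ^-split : ∀ {n} (x : Bits n) {s r} → s ≤ r → τ^ r x ≡ τ^ (r ∸ s) (τ^ s x)
τ^-split x {s} {r} s≤r = trans (cong (λ t → τ^ t x) (sym (m∸n+n≡m s≤r))) (τ^-+ (r ∸ s) s x)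

τ^-monotone-≤ : ∀ {n} (x : Bits n) {s r} → s ≤ r → ∀ {k} → bit (τ^ s x) k ≡ true → bit (τ^ r x) k ≡ true
τ^-monotone-≤ x {s} {r} s≤r {k} b =
  subst (λ y → bit y k ≡ true) (sym (τ^-split x s≤r)) (τ^-monotone (r ∸ s) (τ^ s x) b)

τ^-split< : ∀ {n} (x : Bits n) {s r} → s < r → τ^ r x ≡ τ^ (suc (r ∸ suc s)) (τ^ s x)
τ^-split< x {s} {r} s<r =
  trans (cong (λ t → τ^ t x) (trans (sym (m∸n+n≡m s<r)) (+-suc (r ∸ suc s) s))) (τ^-+ (suc (r ∸ suc s)) s x)

τ^-fixed-or-sets : ∀ {n} (x : Bits n) {s r} → s < r →
                   τ^ r x ≡ τ^ s x ⊎ ∃ λ g → LeftmostUnmatched0 (τ^ s x) g × bit (τ^ r x) g ≡ true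
τ^-fixed-or-sets x {s} {r} s<r rewrite τ^-split< x s<r with U₀ (τ^ s x) in eq
... | []    = inj₁ (τ^-fixed (suc (r ∸ suc s)) (τ^ s x) eq)
... | g ∷ _ = inj₂ (g , leftmostUnmatched0 (τ^ s x) eq , τ^-sets-leftmostUnmatched0 (r ∸ suc s) (τ^ s x) eq)

-- Block codes

allB-∈ : ∀ {A : Set} {p : A → Bool} xs {x} → allB p xs ≡ true → x ∈ xs → p x ≡ true
allB-∈ {p = p} (y ∷ _)  all (here refl) with p y
... | true = refl
allB-∈ {p = p} (y ∷ ys) all (there x∈) with p y
... | true = allB-∈ ys all x∈

allB-cong : ∀ {A : Set} {p q : A → Bool} xs → (∀ x → p x ≡ q x) → allB p xs ≡ allB q xs
allB-cong []       _ = refl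
allB-cong (x ∷ xs) h = cong₂ _∧_ (h x) (allB-cong xs h)

allB-true : ∀ {A : Set} {p : A → Bool} xs → (∀ x → p x ≡ true) → allB p xs ≡ true
allB-true []       _ = refl
allB-true (x ∷ xs) h rewrite h x = allB-true xs h

private
  last-bitᴸ : ∀ b bs → L.last (b ∷ bs) ≡ just (bitᴸ (b ∷ bs) (length bs))
  last-bitᴸ b []       = refl
  last-bitᴸ b (c ∷ bs) = last-bitᴸ c bs

  endsWith0-bitᴸ : ∀ b bs → endsWith0 (b ∷ bs) ≡ not (bitᴸ (b ∷ bs) (length bs))
  endsWith0-bitᴸ b bs rewrite last-bitᴸ b bs with bitᴸ (b ∷ bs) (length bs)
  ... | true  = refl
  ... | false = refl

  β-true∷ : ∀ {m} (w : Bits m) →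
            β (true ∷ w) ≡ (if endsWith0 (true ∷ toList w) then just (blocksGo (toList w) 1 true) else nothing)
  β-true∷ w with endsWith0 (true ∷ toList w)
  ... | true  = refl
  ... | false = refl

β-∷ : ∀ {m} b (w : Bits m) →
      β (b ∷ w) ≡ (if b ∧ not (bit (b ∷ w) m) then just (blocksGo (toList w) 1 b) else nothing)
β-∷     false w = refl
β-∷ {m} true  w = trans (β-true∷ w)
  (cong (λ c → if c then just (blocksGo (toList w) 1 true) else nothing)
        (trans (endsWith0-bitᴸ true (toList w)) (cong (λ k → not (bitᴸ (true ∷ toList w) k)) (length-toList w))))

β-finite⇒first-1-last-0 : ∀ {m} (w : Bits (suc m)) {L} → β w ≡ just L → bit w 0 ≡ true × bit w m ≡ false
β-finite⇒first-1-last-0 {m} (b ∷ w) eq rewrite β-∷ b w with b | bit (b ∷ w) m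
... | true | false = refl , refl

β-finite : ∀ {m} (w : Bits (suc m)) → bit w 0 ≡ true → bit w m ≡ false → ∃ λ L → β w ≡ just L
β-finite {m} (true ∷ w) _ bₘ rewrite β-∷ true w | bₘ = _ , refl

β-first-0 : ∀ {m} (w : Bits (suc m)) → bit w 0 ≡ false → β w ≡ nothing
β-first-0 (false ∷ w) _ = refl

β-last-1 : ∀ {m} (w : Bits (suc m)) → bit w m ≡ true → β w ≡ nothing
β-last-1 {m} (b ∷ w) bₘ rewrite β-∷ b w | bₘ with b
... | true  = refl
... | false = refl

setOneᴸ : List Bool → ℕ → List Bool
setOneᴸ []       _       = []
setOneᴸ (_ ∷ bs) zero    = true ∷ bs
setOneᴸ (b ∷ bs) (suc i) = b ∷ setOneᴸ bs i

toList-setOne : ∀ {n} (w : Bits n) i → toList (setOne w i) ≡ setOneᴸ (toList w) i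
toList-setOne []      _       = refl
toList-setOne (_ ∷ _) zero    = refl
toList-setOne (b ∷ w) (suc i) = cong (b ∷_) (toList-setOne w i)

-- Turning the first 0 of a block 1^a 0^b (b ≥ 2) into a 1 keeps its length a + b.
blocksGo-setOneᴸ : ∀ bs acc prev i →
                   bitᴸ (prev ∷ bs) i ≡ true → bitᴸ bs i ≡ false → bitᴸ bs (suc i) ≡ false →
                   blocksGo (setOneᴸ bs i) acc prev ≡ blocksGo bs acc prev
blocksGo-setOneᴸ (false ∷ false ∷ _) acc true  zero    _ _ _ = refl
blocksGo-setOneᴸ (false ∷ [])        acc true  zero    _ _ _ = refl
blocksGo-setOneᴸ []                  acc prev  zero    _ _ _ = refl
blocksGo-setOneᴸ []                  acc prev  (suc i) _ _ _ = refl
blocksGo-setOneᴸ (true ∷ bs)         acc false (suc i) p z n = cong (acc ∷_) (blocksGo-setOneᴸ bs 1 true i p z n)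
blocksGo-setOneᴸ (true ∷ bs)         acc true  (suc i) p z n = blocksGo-setOneᴸ bs (suc acc) true i p z n
blocksGo-setOneᴸ (false ∷ bs)        acc prev  (suc i) p z n = blocksGo-setOneᴸ bs (suc acc) false i p z n

≡ᵇ-refl : ∀ a → (a ≡ᵇ a) ≡ true
≡ᵇ-refl zero    = refl
≡ᵇ-refl (suc a) = ≡ᵇ-refl a

lexLeq-refl : ∀ L → lexLeq L L ≡ true
lexLeq-refl []       = refl
lexLeq-refl (a ∷ as) rewrite ≡ᵇ-refl a | lexLeq-refl as = ∨-zeroʳ (a <ᵇ a)

codeLeq-refl : ∀ c → codeLeq c c ≡ true
codeLeq-refl nothing  = refl
codeLeq-refl (just L) = lexLeq-refl L

bit-lookup : ∀ {n} (y : Bits n) (i : Fin n) → lookup y i ≡ bit y (toℕ i)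
bit-lookup (_ ∷ _) Fin.zero    = refl
bit-lookup (_ ∷ y) (Fin.suc i) = bit-lookup y i

setOne-≔ : ∀ {n} (y : Bits n) (i : Fin n) → setOne y (toℕ i) ≡ y [ i ]≔ true
setOne-≔ (_ ∷ _) Fin.zero    = refl
setOne-≔ (b ∷ y) (Fin.suc i) = cong (b ∷_) (setOne-≔ y i)

cover-setOne : ∀ {n} (y : Bits n) {g} → g < n → bit y g ≡ false → Cover y (setOne y g)
cover-setOne y {g} g<n b₉ = i , trans (bit-lookup y i) (trans (cong (bit y) toℕi) b₉)
                              , trans (cong (setOne y) (sym toℕi)) (setOne-≔ y i)
  where
  i = fromℕ< g<n
  toℕi = toℕ-fromℕ< g<n

cover-τ : ∀ {n} (y : Bits n) {g gs} → U₀ y ≡ g ∷ gs → Cover y (τ y)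
cover-τ y eq = subst (Cover y) (sym (τ-flips y eq)) (cover-setOne y g<n bit≡0)
  where open LeftmostUnmatched0 (leftmostUnmatched0 y eq)

cover-compl : ∀ {n} {a b : Bits n} → Cover a b → Cover (compl b) (compl a)
cover-compl {a = a} (i , aᵢ , refl) = i , lookup-compl-b , compl-a
  where
  compl-b : compl (a [ i ]≔ true) ≡ compl a [ i ]≔ false
  compl-b = map-[]≔ not a i
  lookup-compl-b : lookup (compl (a [ i ]≔ true)) i ≡ false
  lookup-compl-b = trans (cong (λ v → lookup v i) compl-b) (lookup∘update i (compl a) false)
  compl-a : compl a ≡ compl (a [ i ]≔ true) [ i ]≔ true
  compl-a = sym (begin
    compl (a [ i ]≔ true) [ i ]≔ true   ≡⟨ cong (_[ i ]≔ true) compl-b ⟩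
    (compl a [ i ]≔ false) [ i ]≔ true  ≡⟨ []≔-idempotent (compl a) i ⟩
    compl a [ i ]≔ true                 ≡⟨ cong (compl a [ i ]≔_) (trans (lookup-map i not a) (cong not aᵢ)) ⟨
    compl a [ i ]≔ lookup (compl a) i   ≡⟨ []≔-lookup (compl a) i ⟩
    compl a                             ∎)
    where open ≡-Reasoning

Linked-reverse : ∀ {A : Set} {R : A → A → Set} {xs} → Linked R xs → Linked (flip R) (reverse xs)
Linked-reverse {A} {R} {[]}     _ = []
Linked-reverse {A} {R} {x ∷ xs} l = go xs [] [-] l
  where
  go : ∀ {x} xs acc → Linked (flip R) (x ∷ acc) → Linked R (x ∷ xs) →
       Linked (flip R) (L.foldl (flip _∷_) (x ∷ acc) xs)
  go []       acc r _       = r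
  go (y ∷ xs) acc r (s ∷ l) = go xs (_ ∷ acc) (s ∷ r) l

complChain-Linked : ∀ {n} {c : List (Bits n)} → Linked Cover c → Linked Cover (complChain c)
complChain-Linked l = Linked-reverse (map⁺ (Linked.map cover-compl l))

applyUpTo-cong : ∀ {A : Set} {f g : ℕ → A} n → (∀ j → j < n → f j ≡ g j) → applyUpTo f n ≡ applyUpTo g n
applyUpTo-cong zero    _  = refl
applyUpTo-cong (suc n) eq = cong₂ _∷_ (eq 0 z<s) (applyUpTo-cong n (λ j j<n → eq (suc j) (s<s j<n)))

module _ {A : Set} (p : A → Bool) where

  filterᵇ-applyUpTo-none : ∀ (f : ℕ → A) n → (∀ l → p (f l) ≡ false) → filterᵇ p (applyUpTo f n) ≡ []
  filterᵇ-applyUpTo-none f zero    none = refl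
  filterᵇ-applyUpTo-none f (suc n) none rewrite none 0 = filterᵇ-applyUpTo-none (f ∘ suc) n (none ∘ suc)

  filterᵇ-applyUpTo-all : ∀ (f : ℕ → A) n → (∀ j → j < n → p (f j) ≡ true) →
                          filterᵇ p (applyUpTo f n) ≡ applyUpTo f n
  filterᵇ-applyUpTo-all f zero    _   = refl
  filterᵇ-applyUpTo-all f (suc n) all rewrite all 0 z<s =
    cong (f 0 ∷_) (filterᵇ-applyUpTo-all (f ∘ suc) n (λ j j<n → all (suc j) (s<s j<n)))

  Linked-filterᵇ-applyUpTo :
    ∀ {R : A → A → Set} (f : ℕ → A) →
    (∀ j → p (f j) ≡ true →
           (p (f (suc j)) ≡ true × R (f j) (f (suc j))) ⊎ (∀ l → p (f (suc j + l)) ≡ false)) →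
    ∀ n → Linked R (filterᵇ p (applyUpTo f n))
  Linked-filterᵇ-applyUpTo f step zero    = []
  Linked-filterᵇ-applyUpTo f step (suc n) with p (f 0) in kept
  ... | false = Linked-filterᵇ-applyUpTo (f ∘ suc) (step ∘ suc) n
  ... | true with step 0 kept | n
  ...   | inj₂ none        | n′     rewrite filterᵇ-applyUpTo-none (f ∘ suc) n′ none = [-]
  ...   | inj₁ (kept₁ , r) | zero   = [-]
  ...   | inj₁ (kept₁ , r) | suc n′ = cons r kept₁ (Linked-filterᵇ-applyUpTo (f ∘ suc) (step ∘ suc) (suc n′))
    where
    cons : ∀ {R : A → A → Set} {x y ys} → R x y → p y ≡ true →
           Linked R (filterᵇ p (y ∷ ys)) → Linked R (x ∷ filterᵇ p (y ∷ ys))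
    cons {y = y} r py l with p y
    ... | true = r ∷ l

prefixOnes : ∀ {n} → ℕ → Bits n
prefixOnes {zero}  _       = []
prefixOnes {suc n} zero    = zeros
prefixOnes {suc n} (suc j) = true ∷ prefixOnes j

prefixOnes-0 : ∀ {n} → prefixOnes {n} 0 ≡ zeros
prefixOnes-0 {zero}  = refl
prefixOnes-0 {suc n} = refl

prefixOnes-n : ∀ {n} → prefixOnes {n} n ≡ ones
prefixOnes-n {zero}  = refl
prefixOnes-n {suc n} = cong (true ∷_) prefixOnes-n

bit-prefixOnes-< : ∀ {n} j {t} → t < j → t < n → bit (prefixOnes {n} j) t ≡ true
bit-prefixOnes-< {suc n} (suc j) {zero}  _       _       = refl
bit-prefixOnes-< {suc n} (suc j) {suc t} (s<s p) (s<s q) = bit-prefixOnes-< {n} j p q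

bit-prefixOnes-≥ : ∀ {n} j {t} → j ≤ t → bit (prefixOnes {n} j) t ≡ false
bit-prefixOnes-≥ {zero}  j       _       = refl
bit-prefixOnes-≥ {suc n} zero    {t} _   = bit-zeros {suc n} t
bit-prefixOnes-≥ {suc n} (suc j) (s≤s p) = bit-prefixOnes-≥ {n} j p

setOne-prefixOnes : ∀ {n} j → j < n → setOne (prefixOnes {n} j) j ≡ prefixOnes (suc j)
setOne-prefixOnes {suc n} zero    _       = cong (true ∷_) (sym prefixOnes-0)
setOne-prefixOnes {suc n} (suc j) (s<s p) = cong (true ∷_) (setOne-prefixOnes j p)

U₀-prefixOnes : ∀ {n} j → j < n → ∃ λ gs → U₀ (prefixOnes {n} j) ≡ j ∷ gs
U₀-prefixOnes {suc m} j j<n with last-0⇒unmatched-0 (prefixOnes {suc m} j) (bit-prefixOnes-≥ {suc m} j (≤-pred j<n))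
... | g , gs , eq = gs , trans eq (cong (_∷ gs) (≤-antisym g≤j j≤g))
  where
  open LeftmostUnmatched0 (leftmostUnmatched0 (prefixOnes {suc m} j) eq)
  j≤g : j ≤ g
  j≤g with j ≤? g
  ... | yes p  = p
  ... | no j≰g = ⊥-elim (true≢false (trans (sym (bit-prefixOnes-< {suc m} j (≰⇒> j≰g) g<n)) bit≡0))
  g≤j : g ≤ j
  g≤j = at-most-j preceded
    where
    at-most-j : ∀ {h} → h ≡ 0 ⊎ bit (prefixOnes {suc m} j) (pred h) ≡ true → h ≤ j
    at-most-j {zero}  _         = z≤n
    at-most-j {suc h} (inj₂ bₚ) with h <? j
    ... | yes h<j = h<j
    ... | no h≮j  = ⊥-elim (true≢false (trans (sym bₚ) (bit-prefixOnes-≥ {suc m} j (≮⇒≥ h≮j))))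

τ-prefixOnes : ∀ {n} j → j < n → τ (prefixOnes {n} j) ≡ prefixOnes (suc j)
τ-prefixOnes j j<n = trans (τ-flips (prefixOnes j) (proj₂ (U₀-prefixOnes j j<n))) (setOne-prefixOnes j j<n)

τ^-zeros : ∀ {n} j → j ≤ n → τ^ j (zeros {n}) ≡ prefixOnes j
τ^-zeros zero    _   = sym prefixOnes-0
τ^-zeros (suc j) j<n = trans (cong τ (τ^-zeros j (<⇒≤ j<n))) (τ-prefixOnes j j<n)

take-++ˡ : ∀ {A : Set} (xs ys : List A) → take (length xs) (xs ++ ys) ≡ xs
take-++ˡ []       ys = refl
take-++ˡ (x ∷ xs) ys = cong (x ∷_) (take-++ˡ xs ys)

inner-∷-∷ʳ : ∀ {n} (x : Bits n) xs y → inner (x ∷ (xs ∷ʳ y)) ≡ xs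
inner-∷-∷ʳ x xs y = begin
  drop 1 (take (length (xs ∷ʳ y)) (x ∷ (xs ∷ʳ y)))  ≡⟨ cong (λ l → drop 1 (take l (x ∷ (xs ∷ʳ y)))) len ⟩
  take (length xs) (xs ∷ʳ y)                        ≡⟨ take-++ˡ xs (y ∷ []) ⟩
  xs                                                ∎
  where
  open ≡-Reasoning
  len : length (xs ∷ʳ y) ≡ suc (length xs)
  len = trans (length-++ xs) (+-comm (length xs) 1)

∈-take : ∀ {A : Set} {x : A} n xs → x ∈ take n xs → x ∈ xs
∈-take (suc n) (y ∷ xs) (here p)  = here p
∈-take (suc n) (y ∷ xs) (there p) = there (∈-take n xs p)

∈-drop : ∀ {A : Set} {x : A} n xs → x ∈ drop n xs → x ∈ xs
∈-drop zero    xs       p = p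
∈-drop (suc n) (y ∷ xs) p = there (∈-drop n xs p)

∈-inner : ∀ {n} {x : Bits n} xs → x ∈ inner xs → x ∈ xs
∈-inner xs p = ∈-take (length xs ∸ 1) xs (∈-drop 1 (take (length xs ∸ 1) xs) p)

∈-Unrolled : ∀ {n} {l z : List (Bits n)} → Unrolled l z →
             ∃ λ i → ∀ {a} → a ∈ z → ∃ λ u → u ∈ l × a ≡ rot i u
∈-Unrolled {l = x ∷ xs} (inj₁ (i , _ , refl))     = i , λ a∈ → ∈-map⁻ (rot i) a∈
∈-Unrolled {l = x ∷ xs} (inj₂ (i , _ , _ , refl)) =
  i , λ a∈ → let (u , u∈ , a≡) = ∈-map⁻ (rot i) a∈ in u , ∈-inner (x ∷ xs) u∈ , a≡

gkChain≡applyUpTo : ∀ {n} (x : Bits n) → gkChain x ≡ applyUpTo (λ j → τ^ j x) (suc (length (U₀ x)))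
gkChain≡applyUpTo x = map-upTo (λ j → τ^ j x) _

∈-GKSChain : ∀ {n} {x u : Bits n} → u ∈ filterᵇ isGKSRep (gkChain x) →
             ∃ λ s → u ≡ τ^ s x × isGKSRep u ≡ true
∈-GKSChain {x = x} u∈ with ∈-filter⁻ (T? ∘ isGKSRep) {xs = gkChain x} u∈
... | u∈gk , rep with ∈-map⁻ (λ j → τ^ j x) {xs = upTo (suc (length (U₀ x)))} u∈gk
...   | s , _ , u≡ = s , u≡ , Equivalence.to T-≡ rep

reverse-∷-∷ʳ : ∀ {A : Set} (a : A) xs b → reverse (a ∷ (xs ∷ʳ b)) ≡ b ∷ (reverse xs ∷ʳ a)
reverse-∷-∷ʳ a xs b = trans (unfold-reverse a (xs ∷ʳ b)) (cong (_∷ʳ a) (reverse-++ xs (b ∷ [])))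

complChain-∷-∷ʳ : ∀ {n} (a : Bits n) xs b →
                  complChain (a ∷ (xs ∷ʳ b)) ≡ compl b ∷ (reverse (L.map compl xs) ∷ʳ compl a)
complChain-∷-∷ʳ a xs b = trans (cong (λ l → reverse (compl a ∷ l)) (map-++ compl xs (b ∷ [])))
                               (reverse-∷-∷ʳ (compl a) (L.map compl xs) (compl b))

deduplicate-const : ∀ {A : Set} (_≟_ : (a b : A) → Dec (a ≡ b)) {y} xs →
                    All (_≡ y) xs → deduplicate _≟_ xs ≡ [] ⊎ deduplicate _≟_ xs ≡ y ∷ []
deduplicate-const _≟_ []       []           = inj₁ refl
deduplicate-const _≟_ (x ∷ xs) (refl ∷ all) with deduplicate-const _≟_ xs all
... | inj₁ e rewrite e = inj₂ refl
... | inj₂ e rewrite e = inj₂ (cong (x ∷_) (filter-reject (¬? ∘ (x ≟_)) (λ x≢x → x≢x refl)))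

module _ {n : ℕ} where

  RotatedOrbit : Bits n → ℕ → List (Bits n) → Set
  RotatedOrbit x i z = ∀ {a} → a ∈ z → ∃ λ s → a ≡ rot i (τ^ s x) × isGKSRep (τ^ s x) ≡ true

  RotatedComplOrbit : Bits n → ℕ → List (Bits n) → Set
  RotatedComplOrbit x i w = ∀ {a} → a ∈ w → ∃ λ s → a ≡ rot i (compl (τ^ s x)) × isGKSRep (τ^ s x) ≡ true

  Unrolled-GKSChain : ∀ {c z} → GKSChain n c → Unrolled c z → ∃₂ λ x i → RotatedOrbit x i z
  Unrolled-GKSChain (x , _ , refl , _) un = x , i , λ a∈ →
    let (u , u∈ , a≡) = proj₂ (∈-Unrolled un) a∈
        (s , u≡ , rep) = ∈-GKSChain u∈
    in s , trans a≡ (cong (rot i) u≡) , subst (λ y → isGKSRep y ≡ true) u≡ rep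
    where i = proj₁ (∈-Unrolled un)

  Unrolled-complGKSChain : ∀ {c w} → GKSChain n c → Unrolled (complChain c) w →
                           ∃₂ λ x i → RotatedComplOrbit x i w
  Unrolled-complGKSChain (x , _ , refl , _) un = x , i , λ a∈ →
    let (v , v∈ , a≡) = proj₂ (∈-Unrolled un) a∈
        (u , u∈ , v≡) = ∈-map⁻ compl (reverse⁻ v∈)
        (s , u≡ , rep) = ∈-GKSChain u∈
    in s , trans a≡ (cong (rot i) (trans v≡ (cong compl u≡))) , subst (λ y → isGKSRep y ≡ true) u≡ rep
    where i = proj₁ (∈-Unrolled un)

-- Cyclic positions

%-+-congˡ : ∀ a b c N .{{_ : NonZero N}} → a % N ≡ b % N → (a + c) % N ≡ (b + c) % N
%-+-congˡ a b c N eq = begin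
  (a + c) % N              ≡⟨ %-distribˡ-+ a c N ⟩
  (a % N + c % N) % N      ≡⟨ cong (λ r → (r + c % N) % N) eq ⟩
  (b % N + c % N) % N      ≡⟨ %-distribˡ-+ b c N ⟨
  (b + c) % N              ∎
  where open ≡-Reasoning

module Cyclic {m : ℕ} where

  N : ℕ
  N = suc m

  cbit : Bits N → ℕ → Bool
  cbit y t = bit y (t % N)

  cbit-< : ∀ (y : Bits N) {t} → t < N → cbit y t ≡ bit y t
  cbit-< y t<N = cong (bit y) (m<n⇒m%n≡m t<N)

  cbit-ext : ∀ (a b : Bits N) → (∀ t → cbit a t ≡ cbit b t) → a ≡ b
  cbit-ext a b h = bit-ext a b (λ t t<N → trans (sym (cbit-< a t<N)) (trans (h t) (cbit-< b t<N)))

  cbit-compl : ∀ (y : Bits N) t → cbit (compl y) t ≡ not (cbit y t)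
  cbit-compl y t = bit-compl y (m%n<n t N)

  cbit-cong : ∀ (y : Bits N) t s → t % N ≡ s % N → cbit y t ≡ cbit y s
  cbit-cong y _ _ = cong (bit y)

  suc-% : ∀ t → suc t % N ≡ suc (t % N) % N
  suc-% t = begin
    suc t % N                           ≡⟨ cong (λ k → suc k % N) (m≡m%n+[m/n]*n t N) ⟩
    (suc (t % N) + (t / N) * N) % N     ≡⟨ [m+kn]%n≡m%n (suc (t % N)) (t / N) N ⟩
    suc (t % N) % N                     ∎
    where open ≡-Reasoning

  cbit-σ : ∀ (y : Bits N) t → cbit (σ y) (suc t) ≡ cbit y t
  cbit-σ y t with t % N ≟ m | m%n<n t N
  ... | yes t%N≡m | _ = begin
      bit (σ y) (suc t % N)         ≡⟨ cong (bit (σ y)) suc-t%N≡0 ⟩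
      V.last y                      ≡⟨ bit-last y ⟩
      bit y m                       ≡⟨ cong (bit y) t%N≡m ⟨
      bit y (t % N)                 ∎
    where
    open ≡-Reasoning
    suc-t%N≡0 : suc t % N ≡ 0
    suc-t%N≡0 = trans (suc-% t) (trans (cong (λ r → suc r % N) t%N≡m) (n%n≡0 N))
  ... | no t%N≢m | t%N<N = begin
      bit (σ y) (suc t % N)         ≡⟨ cong (bit (σ y)) (trans (suc-% t) (m<n⇒m%n≡m (s<s t%N<m))) ⟩
      bit (V.init y) (t % N)        ≡⟨ bit-init y t%N<m ⟩
      bit y (t % N)                 ∎
    where
    open ≡-Reasoning
    t%N<m : t % N < m
    t%N<m = ≤∧≢⇒< (≤-pred t%N<N) t%N≢m

  cbit-rot : ∀ i (y : Bits N) t → cbit (rot i y) (t + i) ≡ cbit y t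
  cbit-rot zero    y t = cong (cbit y) (+-identityʳ t)
  cbit-rot (suc i) y t = begin
    cbit (σ (rot i y)) (t + suc i)   ≡⟨ cong (cbit (σ (rot i y))) (+-suc t i) ⟩
    cbit (σ (rot i y)) (suc (t + i)) ≡⟨ cbit-σ (rot i y) (t + i) ⟩
    cbit (rot i y) (t + i)           ≡⟨ cbit-rot i y t ⟩
    cbit y t                         ∎
    where open ≡-Reasoning

  -- Shifting by i * m is shifting back by i modulo N.
  cbit-rot⁻¹ : ∀ i (y : Bits N) t → cbit (rot i y) t ≡ cbit y (t + i * m)
  cbit-rot⁻¹ i y t = begin
    cbit (rot i y) t                 ≡⟨ cong (bit (rot i y)) ([m+kn]%n≡m%n t i N) ⟨
    cbit (rot i y) (t + i * N)       ≡⟨ cong (cbit (rot i y)) (expand t i m) ⟩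
    cbit (rot i y) (t + i * m + i)   ≡⟨ cbit-rot i y (t + i * m) ⟩
    cbit y (t + i * m)               ∎
    where
    open ≡-Reasoning
    expand : ∀ t i m → t + i * suc m ≡ t + i * m + i
    expand = solve-∀

module _ {k : ℕ} where
  open Cyclic {suc k}

  private
    m : ℕ
    m = suc k

  -- A 0 at t between a 1 and a 0, read cyclically: t + m is the predecessor of t.
  Flippable : Bits N → ℕ → Set
  Flippable y t = cbit y t ≡ false × cbit y (t + m) ≡ true × cbit y (suc t) ≡ false

  Flippable-% : ∀ y t → Flippable y t → Flippable y (t % N)
  Flippable-% y t (b₀ , bₚ , bₛ) =
      trans (cbit-cong y (t % N) t (m%n%n≡m%n t N)) b₀
    , trans (cbit-cong y (t % N + m) (t + m) (%-+-congˡ (t % N) t m N (m%n%n≡m%n t N))) bₚ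
    , trans (cbit-cong y (suc (t % N)) (suc t) (sym (suc-% t))) bₛ

  Flippable-rot : ∀ y t i → Flippable y t → Flippable (rot i y) (t + i)
  Flippable-rot y t i (b₀ , bₚ , bₛ) =
      trans (cbit-rot i y t) b₀
    , trans (cong (cbit (rot i y)) (swap t i m)) (trans (cbit-rot i y (t + m)) bₚ)
    , trans (cbit-rot i y (suc t)) bₛ
    where
    swap : ∀ t i m → t + i + m ≡ t + m + i
    swap = solve-∀

  β-setOne : ∀ (y : Bits N) h → h < N → Flippable y h → β (setOne y h) ≡ β y
  β-setOne y zero _ (b₀ , bₚ , _) =
    trans (β-last-1 (setOne y 0) (trans (bit-setOne-other y (λ ())) (trans (sym (cbit-< y ≤-refl)) bₚ)))
          (sym (β-first-0 y b₀))
  β-setOne y (suc h) h<N (_ , _ , bₛ) with suc h ≟ m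
  ... | yes refl = trans (β-first-0 (setOne y m) (trans (bit-setOne-other y (λ ())) first-0)) (sym (β-first-0 y first-0))
    where
    first-0 : bit y 0 ≡ false
    first-0 = trans (cbit-cong y 0 N (sym (n%n≡0 N))) bₛ
  β-setOne (b ∷ w) (suc h) h<N (b₀ , bₚ , bₛ) | no 1+h≢m = begin
    β (b ∷ setOne w h)
      ≡⟨ β-∷ b (setOne w h) ⟩
    (if b ∧ not (bit (b ∷ setOne w h) m) then just (blocksGo (toList (setOne w h)) 1 b) else nothing)
      ≡⟨ cong₂ (λ c l → if b ∧ not c then just l else nothing) last-same blocks-same ⟩
    (if b ∧ not (bit (b ∷ w) m) then just (blocksGo (toList w) 1 b) else nothing)
      ≡⟨ β-∷ b w ⟨
    β (b ∷ w) ∎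
    where
    open ≡-Reasoning
    1+h<m : suc h < m
    1+h<m = ≤∧≢⇒< (≤-pred h<N) 1+h≢m
    last-same : bit (b ∷ setOne w h) m ≡ bit (b ∷ w) m
    last-same = bit-setOne-other (b ∷ w) (<⇒≢ 1+h<m)
    prev% : (suc h + m) % N ≡ h
    prev% = trans (cong (_% N) (sym (+-suc h m))) (trans ([m+n]%n≡m%n h N) (m<n⇒m%n≡m (<-trans (n<1+n h) h<N)))
    blocks-same : blocksGo (toList (setOne w h)) 1 b ≡ blocksGo (toList w) 1 b
    blocks-same = trans (cong (λ l → blocksGo l 1 b) (toList-setOne w h))
      (blocksGo-setOneᴸ (toList w) 1 b h
        (trans (cong (bit (b ∷ w)) (sym prev%)) bₚ)
        (trans (sym (cbit-< (b ∷ w) h<N)) b₀)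
        (trans (sym (cbit-< (b ∷ w) (s<s 1+h<m))) bₛ))

  csetOne : Bits N → ℕ → Bits N
  csetOne y t = setOne y (t % N)

  β-csetOne : ∀ (y : Bits N) t → Flippable y t → β (csetOne y t) ≡ β y
  β-csetOne y t fl = β-setOne y (t % N) (m%n<n t N) (Flippable-% y t fl)

  private
    rot-shift⇒ : ∀ i s t → (s + i * m) % N ≡ t % N → s % N ≡ (t + i) % N
    rot-shift⇒ i s t eq = begin
      s % N                    ≡⟨ [m+kn]%n≡m%n s i N ⟨
      (s + i * N) % N          ≡⟨ cong (_% N) (expand s i k) ⟩
      (s + i * m + i) % N      ≡⟨ %-+-congˡ (s + i * m) t i N eq ⟩
      (t + i) % N              ∎
      where
      open ≡-Reasoning
      expand : ∀ s i k → s + i * suc (suc k) ≡ s + i * suc k + i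
      expand = solve-∀

    rot-shift⇐ : ∀ i s t → s % N ≡ (t + i) % N → (s + i * m) % N ≡ t % N
    rot-shift⇐ i s t eq = begin
      (s + i * m) % N          ≡⟨ %-+-congˡ s (t + i) (i * m) N eq ⟩
      (t + i + i * m) % N      ≡⟨ cong (_% N) (collect t i k) ⟩
      (t + i * N) % N          ≡⟨ [m+kn]%n≡m%n t i N ⟩
      t % N                    ∎
      where
      open ≡-Reasoning
      collect : ∀ t i k → t + i + i * suc k ≡ t + i * suc (suc k)
      collect = solve-∀

  cbit-csetOne-same : ∀ (y : Bits N) t s → s % N ≡ t % N → cbit (csetOne y t) s ≡ true
  cbit-csetOne-same y t _ eq = trans (cong (bit (csetOne y t)) eq) (bit-setOne-same y (m%n<n t N))

  cbit-csetOne-other : ∀ (y : Bits N) t s → s % N ≢ t % N → cbit (csetOne y t) s ≡ cbit y s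
  cbit-csetOne-other y _ _ ne = bit-setOne-other y (ne ∘ sym)

  rot-csetOne : ∀ i (y : Bits N) t → rot i (csetOne y t) ≡ csetOne (rot i y) (t + i)
  rot-csetOne i y t = cbit-ext _ _ same-bits
    where
    same-bits : ∀ s → cbit (rot i (csetOne y t)) s ≡ cbit (csetOne (rot i y) (t + i)) s
    same-bits s with s % N ≟ (t + i) % N
    ... | yes eq = begin
      cbit (rot i (csetOne y t)) s            ≡⟨ cbit-rot⁻¹ i (csetOne y t) s ⟩
      cbit (csetOne y t) (s + i * m)          ≡⟨ cbit-csetOne-same y t (s + i * m) (rot-shift⇐ i s t eq) ⟩
      true                                    ≡⟨ cbit-csetOne-same (rot i y) (t + i) s eq ⟨
      cbit (csetOne (rot i y) (t + i)) s      ∎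
      where open ≡-Reasoning
    ... | no ne  = begin
      cbit (rot i (csetOne y t)) s            ≡⟨ cbit-rot⁻¹ i (csetOne y t) s ⟩
      cbit (csetOne y t) (s + i * m)          ≡⟨ cbit-csetOne-other y t (s + i * m) (ne ∘ rot-shift⇒ i s t) ⟩
      cbit y (s + i * m)                      ≡⟨ cbit-rot⁻¹ i y s ⟨
      cbit (rot i y) s                        ≡⟨ cbit-csetOne-other (rot i y) (t + i) s ne ⟨
      cbit (csetOne (rot i y) (t + i)) s      ∎
      where open ≡-Reasoning

  isGKSRep-csetOne : ∀ (y : Bits N) t → Flippable y t → isGKSRep (csetOne y t) ≡ isGKSRep y
  isGKSRep-csetOne y t fl = allB-cong (upTo N) (λ i → cong₂ codeLeq (β-rot-csetOne 0) (β-rot-csetOne i))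
    where
    β-rot-csetOne : ∀ i → β (rot i (csetOne y t)) ≡ β (rot i y)
    β-rot-csetOne i = trans (cong β (rot-csetOne i y t)) (β-csetOne (rot i y) (t + i) (Flippable-rot y t i fl))

  NonConstant : Bits N → Set
  NonConstant y = (∃ λ t → cbit y t ≡ true) × (∃ λ t → cbit y t ≡ false)

  private
    walk : ∀ (u : Bits N) q t → cbit u q ≡ false → cbit u (q + t) ≡ true →
           ∃ λ p → cbit u p ≡ true × cbit u (p + m) ≡ false
    walk u q zero    b₀ b₁ = ⊥-elim (true≢false (trans (sym b₁) (trans (cong (cbit u) (+-identityʳ q)) b₀)))
    walk u q (suc t) b₀ b₁ with cbit u (q + t) in e
    ... | true  = walk u q t b₀ e
    ... | false = q + suc t , b₁ , trans (cbit-cong u (q + suc t + m) (q + t) back) e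
      where
      back : (q + suc t + m) % N ≡ (q + t) % N
      back = trans (cong (_% N) (rearrange q t k)) ([m+n]%n≡m%n (q + t) N)
        where
        rearrange : ∀ q t k → q + suc t + suc k ≡ q + t + suc (suc k)
        rearrange = solve-∀

  rising-edge↻ : ∀ (u : Bits N) → NonConstant u → ∃ λ p → cbit u p ≡ true × cbit u (p + m) ≡ false
  rising-edge↻ u ((a , bₐ) , (q , b_q)) = walk u q (a + q * m) b_q (trans (cbit-cong u (q + (a + q * m)) a shift) bₐ)
    where
    shift : (q + (a + q * m)) % N ≡ a % N
    shift = trans (cong (_% N) (rearrange q a k)) ([m+kn]%n≡m%n a q N)
      where
      rearrange : ∀ q a k → q + (a + q * suc k) ≡ a + q * suc (suc k)
      rearrange = solve-∀

  -- Since m ≡ -1 (mod N), rotating by p * m moves position p to the front.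
  rot-to-front : ∀ (u : Bits N) p → cbit u p ≡ true → cbit u (p + m) ≡ false →
                 ∃ λ i → i < N × ∃ λ L → β (rot i u) ≡ just L
  rot-to-front u p bₚ bₚ₋₁ = i , m%n<n (p * m) N , β-finite (rot i u) first-1 last-0
    where
    i = (p * m) % N
    i*m≡p : (i * m) % N ≡ p % N
    i*m≡p = begin
      ((p * m) % N * m) % N            ≡⟨ %-distribˡ-* ((p * m) % N) m N ⟩
      ((p * m) % N % N * (m % N)) % N  ≡⟨ cong (λ r → (r * (m % N)) % N) (m%n%n≡m%n (p * m) N) ⟩
      ((p * m) % N * (m % N)) % N      ≡⟨ %-distribˡ-* (p * m) m N ⟨
      (p * m * m) % N                  ≡⟨ cong (_% N) (square p k) ⟩
      (p + p * k * N) % N              ≡⟨ [m+kn]%n≡m%n p (p * k) N ⟩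
      p % N                            ∎
      where
      open ≡-Reasoning
      square : ∀ p k → p * suc k * suc k ≡ p + p * k * suc (suc k)
      square = solve-∀
    first-1 : bit (rot i u) 0 ≡ true
    first-1 = trans (cbit-rot⁻¹ i u 0) (trans (cbit-cong u (i * m) p i*m≡p) bₚ)
    last-0 : bit (rot i u) m ≡ false
    last-0 = begin
      bit (rot i u) m            ≡⟨ cbit-< (rot i u) ≤-refl ⟨
      cbit (rot i u) m           ≡⟨ cbit-rot⁻¹ i u m ⟩
      cbit u (m + i * m)         ≡⟨ cbit-cong u (m + i * m) (p + m) shifted ⟩
      cbit u (p + m)             ≡⟨ bₚ₋₁ ⟩
      false                      ∎
      where
      open ≡-Reasoning
      shifted : (m + i * m) % N ≡ (p + m) % N
      shifted = trans (cong (_% N) (+-comm m (i * m))) (%-+-congˡ (i * m) p m N i*m≡p)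

  isGKSRep-minimal : ∀ (u : Bits N) → isGKSRep u ≡ true → ∀ {i} → i < N →
                     codeLeq (β u) (β (rot i u)) ≡ true
  isGKSRep-minimal u rep i<N = allB-∈ {p = λ i → codeLeq (β u) (β (rot i u))} (upTo N) rep (∈-upTo⁺ i<N)

  -- Some rotation has a finite block code, so the minimal one, β u, is finite.
  isGKSRep⇒first-1-last-0 : ∀ (u : Bits N) → isGKSRep u ≡ true → NonConstant u →
                            bit u 0 ≡ true × bit u m ≡ false
  isGKSRep⇒first-1-last-0 u rep nc with rising-edge↻ u nc
  ... | p , bₚ , bₚ₋₁ with rot-to-front u p bₚ bₚ₋₁
  ...   | i , i<N , L , βrot = finite-code (isGKSRep-minimal u rep i<N)
    where
    finite-code : codeLeq (β u) (β (rot i u)) ≡ true → bit u 0 ≡ true × bit u m ≡ false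
    finite-code le with β u in βu
    ... | just _  = β-finite⇒first-1-last-0 u βu
    ... | nothing rewrite βrot with () ← le

  isGKSRep⇒first-1 : ∀ (u : Bits N) → isGKSRep u ≡ true → (∃ λ t → cbit u t ≡ true) →
                     ∀ t → cbit u t ≡ false → bit u 0 ≡ true
  isGKSRep⇒first-1 u rep has-1 t u-0 = proj₁ (isGKSRep⇒first-1-last-0 u rep (has-1 , (t , u-0)))

  τ^-NonConstant : ∀ (x : Bits N) → U₁ x ≡ [] → ∀ {a} → bit x a ≡ true → ∀ j → NonConstant (τ^ j x)
  τ^-NonConstant x u₁ {a} bₐ j with rising-edge x (U₁≡[]⇒first-0 x u₁) bₐ
  ... | d , b_d , b_d+1 =
      (a , trans (cbit-< (τ^ j x) (bit-true⇒< x bₐ)) (τ^-monotone j x bₐ))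
    , (d , trans (cbit-< (τ^ j x) (<-trans (n<1+n d) (bit-true⇒< x b_d+1))) (τ^-keeps-0-before-1 j x b_d b_d+1))

  setOne≡csetOne : ∀ (y : Bits N) {g} → g < N → setOne y g ≡ csetOne y g
  setOne≡csetOne y g<N = cong (setOne y) (sym (m<n⇒m%n≡m g<N))

  leftmostUnmatched0-Flippable : ∀ (y : Bits N) {g} → LeftmostUnmatched0 y g → bit y 0 ≡ true → suc g < N →
                                 Flippable y g
  leftmostUnmatched0-Flippable y lu b₀ 1+g<N with leftmostUnmatched0-after-1 b₀ lu
  ... | g₀ , refl , b₉₀ =
      trans (cbit-< y g<n) bit≡0
    , trans (cbit-cong y (suc g₀ + m) g₀ (trans (cong (_% N) (sym (+-suc g₀ m))) ([m+n]%n≡m%n g₀ N)))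
            (trans (cbit-< y (<-trans (n<1+n g₀) g<n)) b₉₀)
    , trans (cbit-< y 1+g<N) (followed 1+g<N)
    where open LeftmostUnmatched0 lu

  isGKSRep-τ-interior : ∀ (y : Bits N) {g gs} → isGKSRep y ≡ true → bit y 0 ≡ true →
                        U₀ y ≡ g ∷ gs → suc g < N → isGKSRep (τ y) ≡ true
  isGKSRep-τ-interior y {g} rep b₀ eq 1+g<N = begin
    isGKSRep (τ y)            ≡⟨ cong isGKSRep (trans (τ-flips y eq) (setOne≡csetOne y (LeftmostUnmatched0.g<n lu))) ⟩
    isGKSRep (csetOne y g)    ≡⟨ isGKSRep-csetOne y g (leftmostUnmatched0-Flippable y lu b₀ 1+g<N) ⟩
    isGKSRep y                ≡⟨ rep ⟩
    true                      ∎
    where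
    open ≡-Reasoning
    lu = leftmostUnmatched0 y eq

  -- Once τ has set the last bit, no later word ends in 0, so none is a representative.
  isGKSRep-τ : ∀ (y : Bits N) → (∀ l → NonConstant (τ^ l y)) → isGKSRep y ≡ true →
               (isGKSRep (τ y) ≡ true × Cover y (τ y)) ⊎ (∀ l → isGKSRep (τ^ (suc l) y) ≡ false)
  isGKSRep-τ y nc rep = by-position (suc g <? N)
    where
    first-1-last-0 = isGKSRep⇒first-1-last-0 y rep (nc 0)
    unmatched = last-0⇒unmatched-0 y (proj₂ first-1-last-0)
    g = proj₁ unmatched
    eq = proj₂ (proj₂ unmatched)

    by-position : Dec (suc g < N) →
                  (isGKSRep (τ y) ≡ true × Cover y (τ y)) ⊎ (∀ l → isGKSRep (τ^ (suc l) y) ≡ false)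
    by-position (yes 1+g<N) = inj₁ (isGKSRep-τ-interior y rep (proj₁ first-1-last-0) eq 1+g<N , cover-τ y eq)
    by-position (no 1+g≮N)  = inj₂ λ l → ¬-not (λ rep′ →
        true≢false (trans (sym (last-1 l)) (proj₂ (isGKSRep⇒first-1-last-0 (τ^ (suc l) y) rep′ (nc (suc l))))))
      where
      g≡m : g ≡ m
      g≡m = ≤-antisym (≤-pred (LeftmostUnmatched0.g<n (leftmostUnmatched0 y eq))) (≤-pred (≮⇒≥ 1+g≮N))
      last-1 : ∀ l → bit (τ^ (suc l) y) m ≡ true
      last-1 l = subst (λ h → bit (τ^ (suc l) y) h ≡ true) g≡m (τ^-sets-leftmostUnmatched0 l y eq)

  Linked-GKS-orbit : ∀ (x : Bits N) → (∀ l → NonConstant (τ^ l x)) →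
                     ∀ n → Linked Cover (filterᵇ isGKSRep (applyUpTo (λ j → τ^ j x) n))
  Linked-GKS-orbit x nc = Linked-filterᵇ-applyUpTo isGKSRep (λ j → τ^ j x) step
    where
    step : ∀ j → isGKSRep (τ^ j x) ≡ true →
           (isGKSRep (τ^ (suc j) x) ≡ true × Cover (τ^ j x) (τ^ (suc j) x)) ⊎
           (∀ l → isGKSRep (τ^ (suc j + l) x) ≡ false)
    step j rep = Sum.map₂ later (isGKSRep-τ (τ^ j x) (λ l → subst NonConstant (τ^-+ l j x) (nc (l + j))) rep)
      where
      later : (∀ l → isGKSRep (τ^ (suc l) (τ^ j x)) ≡ false) → ∀ l → isGKSRep (τ^ (suc j + l) x) ≡ false
      later none l = trans (cong (λ i → isGKSRep (τ^ (suc i) x)) (+-comm j l))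
                           (trans (cong isGKSRep (τ^-+ (suc l) j x)) (none l))

  isGKSRep-intro : ∀ (y : Bits N) → (∀ i → codeLeq (β y) (β (rot i y)) ≡ true) → isGKSRep y ≡ true
  isGKSRep-intro y = allB-true (upTo N)

  rot-id : ∀ i (y : Bits N) → (i * m) % N ≡ 0 → rot i y ≡ y
  rot-id i y i*m≡0 = cbit-ext (rot i y) y λ t →
    trans (cbit-rot⁻¹ i y t)
          (cbit-cong y (t + i * m) t (trans (cong (_% N) (+-comm t (i * m))) (%-+-congˡ (i * m) 0 t N i*m≡0)))

  rot-zeros : ∀ i → rot i (zeros {N}) ≡ zeros
  rot-zeros i = cbit-ext _ _ λ t →
    trans (cbit-rot⁻¹ i zeros t) (trans (bit-zeros {N} ((t + i * m) % N)) (sym (bit-zeros {N} (t % N))))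

  rot-ones : ∀ i → rot i (ones {N}) ≡ ones
  rot-ones i = cbit-ext _ _ λ t →
    trans (cbit-rot⁻¹ i ones t) (trans (bit-ones {N} (m%n<n (t + i * m) N)) (sym (bit-ones {N} (m%n<n t N))))

  isGKSRep-rot-invariant : ∀ (y : Bits N) → (∀ i → rot i y ≡ y) → isGKSRep y ≡ true
  isGKSRep-rot-invariant y inv = isGKSRep-intro y λ i →
    subst (λ z → codeLeq (β y) (β z) ≡ true) (sym (inv i)) (codeLeq-refl (β y))

  -- The only rotation of 10⋯0 with a finite block code is 10⋯0 itself.
  isGKSRep-prefixOnes-1 : isGKSRep (prefixOnes {N} 1) ≡ true
  isGKSRep-prefixOnes-1 = isGKSRep-intro y₁ λ i → by-code i (β (rot i y₁)) refl
    where
    y₁ = prefixOnes {N} 1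
    rotated-back : ∀ i → bit (rot i y₁) 0 ≡ true → rot i y₁ ≡ y₁
    rotated-back i b₀ with (i * m) % N in e
    ... | zero  = rot-id i y₁ e
    ... | suc r = ⊥-elim (true≢false (trans (sym b₀)
                    (trans (cbit-rot⁻¹ i y₁ 0) (trans (cong (bit y₁) e) (bit-prefixOnes-≥ {N} 1 {suc r} (s≤s z≤n))))))
    by-code : ∀ i c → β (rot i y₁) ≡ c → codeLeq (β y₁) (β (rot i y₁)) ≡ true
    by-code i nothing  eq rewrite proj₂ (β-finite y₁ refl (bit-prefixOnes-≥ {N} 1 {m} (s≤s z≤n))) | eq = refl
    by-code i (just _) eq rewrite rotated-back i (proj₁ (β-finite⇒first-1-last-0 (rot i y₁) eq)) = codeLeq-refl (β y₁)

  isGKSRep-prefixOnes : ∀ j → j ≤ N → isGKSRep (prefixOnes {N} j) ≡ true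
  isGKSRep-prefixOnes zero          _   = isGKSRep-rot-invariant zeros rot-zeros
  isGKSRep-prefixOnes (suc zero)    _   = isGKSRep-prefixOnes-1
  isGKSRep-prefixOnes (suc (suc j)) 2+j≤N =
    by-length (suc (suc j) ≟ N) (isGKSRep-prefixOnes (suc j) (<⇒≤ 2+j≤N))
    where
    by-length : Dec (suc (suc j) ≡ N) → isGKSRep (prefixOnes {N} (suc j)) ≡ true →
                isGKSRep (prefixOnes {N} (suc (suc j))) ≡ true
    by-length (yes 2+j≡N) _ =
      trans (cong isGKSRep (trans (cong prefixOnes 2+j≡N) (prefixOnes-n {N}))) (isGKSRep-rot-invariant ones rot-ones)
    by-length (no 2+j≢N) rep = trans (cong isGKSRep (sym (τ-prefixOnes (suc j) 1+j<N)))
      (isGKSRep-τ-interior (prefixOnes (suc j)) rep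
        (bit-prefixOnes-< {N} (suc j) z<s z<s) (proj₂ (U₀-prefixOnes (suc j) 1+j<N)) 2+j<N)
      where
      2+j<N : suc (suc j) < N
      2+j<N = ≤∧≢⇒< 2+j≤N 2+j≢N
      1+j<N : suc j < N
      1+j<N = <-trans (n<1+n (suc j)) 2+j<N

  zerosChain : List (Bits N)
  zerosChain = applyUpTo prefixOnes (suc N)

  GKSChain-zeros : filterᵇ isGKSRep (gkChain (zeros {N})) ≡ zerosChain
  GKSChain-zeros = begin
    filterᵇ isGKSRep (gkChain zeros)
      ≡⟨ cong (filterᵇ isGKSRep) (gkChain≡applyUpTo zeros) ⟩
    filterᵇ isGKSRep (applyUpTo (λ j → τ^ j zeros) (suc (length (U₀ (zeros {N})))))
      ≡⟨ cong (λ K → filterᵇ isGKSRep (applyUpTo (λ j → τ^ j zeros) (suc K))) (length-U₀-zeros N) ⟩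
    filterᵇ isGKSRep (applyUpTo (λ j → τ^ j zeros) (suc N))
      ≡⟨ cong (filterᵇ isGKSRep) (applyUpTo-cong (suc N) (λ j j≤N → τ^-zeros j (≤-pred j≤N))) ⟩
    filterᵇ isGKSRep zerosChain
      ≡⟨ filterᵇ-applyUpTo-all isGKSRep prefixOnes (suc N) (λ j j≤N → isGKSRep-prefixOnes j (≤-pred j≤N)) ⟩
    zerosChain ∎
    where open ≡-Reasoning

  Linked-zerosChain : Linked Cover zerosChain
  Linked-zerosChain = applyUpTo⁺₁ prefixOnes (suc N) λ {j} j<N →
    subst (Cover (prefixOnes j)) (setOne-prefixOnes j (≤-pred j<N))
      (cover-setOne (prefixOnes j) (≤-pred j<N) (bit-prefixOnes-≥ {N} j ≤-refl))

  GKSChain-Linked : ∀ c → GKSChain N c → Linked Cover c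
  GKSChain-Linked c (x , u₁ , c≡ , _) = subst (Linked Cover) (sym c≡) (by-cases (zeros⊎has-1 x))
    where
    by-cases : x ≡ zeros ⊎ (∃ λ a → bit x a ≡ true) → Linked Cover (filterᵇ isGKSRep (gkChain x))
    by-cases (inj₁ x≡0)      = subst (λ y → Linked Cover (filterᵇ isGKSRep (gkChain y))) (sym x≡0)
                                 (subst (Linked Cover) (sym GKSChain-zeros) Linked-zerosChain)
    by-cases (inj₂ (a , bₐ)) = subst (λ l → Linked Cover (filterᵇ isGKSRep l)) (sym (gkChain≡applyUpTo x))
                                 (Linked-GKS-orbit x (τ^-NonConstant x u₁ bₐ) _)

  -- Words shared by unrolled chains

  neckSize-zeros : neckSize (zeros {N}) ≤ 1
  neckSize-zeros = at-most-one (deduplicate-const (Vecₚ.≡-dec _≟ᵇ_) (L.map (λ i → rot i zeros) (upTo N)) all-zeros)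
    where
    all-zeros : All (_≡ zeros) (L.map (λ i → rot i (zeros {N})) (upTo N))
    all-zeros = All.tabulate rotation-zeros
      where
      rotation-zeros : ∀ {x} → x ∈ L.map (λ i → rot i (zeros {N})) (upTo N) → x ≡ zeros
      rotation-zeros x∈ with ∈-map⁻ (λ i → rot i (zeros {N})) {xs = upTo N} x∈
      ... | i , _ , refl = rot-zeros i
    at-most-one : ∀ {l : List (Bits N)} → l ≡ [] ⊎ l ≡ zeros ∷ [] → length l ≤ 1
    at-most-one (inj₁ refl) = z≤n
    at-most-one (inj₂ refl) = ≤-refl

  NonConstant-rot : ∀ (y : Bits N) i → NonConstant y → NonConstant (rot i y)
  NonConstant-rot y i ((t , b₁) , (s , b₀)) = (t + i , trans (cbit-rot i y t) b₁) , (s + i , trans (cbit-rot i y s) b₀)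

  NonConstant-compl : ∀ (y : Bits N) → NonConstant y → NonConstant (compl y)
  NonConstant-compl y ((t , b₁) , (s , b₀)) = (s , trans (cbit-compl y s) (cong not b₀)) , (t , trans (cbit-compl y t) (cong not b₁))

  NonConstant⇒≢zeros : ∀ {y : Bits N} → NonConstant y → y ≢ zeros
  NonConstant⇒≢zeros ((t , b₁) , _) refl = true≢false (trans (sym b₁) (bit-zeros {N} (t % N)))

  NonConstant⇒≢ones : ∀ {y : Bits N} → NonConstant y → y ≢ ones
  NonConstant⇒≢ones (_ , (t , b₀)) refl = true≢false (trans (sym (bit-ones {N} (m%n<n t N))) b₀)

  rotations-NonConstant : ∀ {l} i → All NonConstant l → ¬ (zeros ∈ L.map (rot i) l ⊎ ones ∈ L.map (rot i) l)
  rotations-NonConstant {l} i nc = Sum.[ not-in NonConstant⇒≢zeros , not-in NonConstant⇒≢ones ]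
    where
    not-in : ∀ {c} → (∀ {y} → NonConstant y → y ≢ c) → c ∉ L.map (rot i) l
    not-in ≢c c∈ with ∈-map⁻ (rot i) c∈
    ... | u , u∈ , c≡ = ≢c (NonConstant-rot u i (All.lookup nc u∈)) (sym c≡)

  Unrolled-NonConstant : ∀ {l z} → All NonConstant l → Unrolled l z → ¬ (zeros ∈ z ⊎ ones ∈ z)
  Unrolled-NonConstant {x ∷ xs} nc (inj₁ (i , _ , refl))     = rotations-NonConstant i nc
  Unrolled-NonConstant {x ∷ xs} nc (inj₂ (i , _ , _ , refl)) = rotations-NonConstant i (All.tabulate (All.lookup nc ∘ ∈-inner (x ∷ xs)))

  Unrolled-zeros-to-ones : ∀ {l z} mid → l ≡ zeros ∷ (mid ∷ʳ ones) → All NonConstant mid → Unrolled l z →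
                           zeros ∈ z ⊎ ones ∈ z → z ≡ l
  Unrolled-zeros-to-ones mid refl nc (inj₁ (i , i<size , refl)) _ with ≤-trans i<size neckSize-zeros
  ... | s≤s z≤n = map-id _
  Unrolled-zeros-to-ones mid refl nc (inj₂ (i , _ , _ , refl)) zo rewrite inner-∷-∷ʳ zeros mid ones =
    ⊥-elim (rotations-NonConstant i nc zo)

  compl-zeros : compl (zeros {N}) ≡ ones
  compl-zeros = map-replicate not false N

  compl-ones : compl (ones {N}) ≡ zeros
  compl-ones = map-replicate not true N

  zerosChain-middle : List (Bits N)
  zerosChain-middle = applyUpTo (prefixOnes ∘ suc) m

  zerosChain-shape : zerosChain ≡ zeros ∷ (zerosChain-middle ∷ʳ ones)
  zerosChain-shape = cong (zeros ∷_) (sym (trans (cong (zerosChain-middle ∷ʳ_) (sym (prefixOnes-n {N})))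
                                                 (applyUpTo-∷ʳ (prefixOnes ∘ suc) m)))

  complChain-zerosChain-shape : complChain zerosChain ≡ zeros ∷ (reverse (L.map compl zerosChain-middle) ∷ʳ ones)
  complChain-zerosChain-shape = begin
    complChain zerosChain
      ≡⟨ cong complChain zerosChain-shape ⟩
    complChain (zeros ∷ (zerosChain-middle ∷ʳ ones))
      ≡⟨ complChain-∷-∷ʳ zeros zerosChain-middle ones ⟩
    compl ones ∷ (reverse (L.map compl zerosChain-middle) ∷ʳ compl zeros)
      ≡⟨ cong₂ (λ a b → a ∷ (reverse (L.map compl zerosChain-middle) ∷ʳ b)) compl-ones compl-zeros ⟩
    zeros ∷ (reverse (L.map compl zerosChain-middle) ∷ʳ ones) ∎
    where open ≡-Reasoning

  zerosChain-middle-NonConstant : All NonConstant zerosChain-middle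
  zerosChain-middle-NonConstant = All.tabulate λ y∈ → by-index (∈-applyUpTo⁻ (prefixOnes ∘ suc) y∈)
    where
    by-index : ∀ {y} → ∃ (λ j → j < m × y ≡ prefixOnes (suc j)) → NonConstant y
    by-index (j , j<m , refl) = (0 , refl) , (m , trans (cbit-< (prefixOnes (suc j)) ≤-refl) (bit-prefixOnes-≥ {N} (suc j) j<m))

  reverse-compl-NonConstant : ∀ {ys} → All NonConstant ys → All NonConstant (reverse (L.map compl ys))
  reverse-compl-NonConstant {ys} all = All.tabulate λ y∈ → by-member (∈-map⁻ compl (reverse⁻ y∈))
    where
    by-member : ∀ {y} → ∃ (λ u → u ∈ ys × y ≡ compl u) → NonConstant y
    by-member (u , u∈ , refl) = NonConstant-compl u (All.lookup all u∈)

  Unrolled-zerosChain : ∀ {z} → Unrolled zerosChain z → zeros ∈ z ⊎ ones ∈ z → z ≡ zerosChain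
  Unrolled-zerosChain = Unrolled-zeros-to-ones zerosChain-middle zerosChain-shape zerosChain-middle-NonConstant

  Unrolled-complChain-zerosChain : ∀ {w} → Unrolled (complChain zerosChain) w → zeros ∈ w ⊎ ones ∈ w →
                                   w ≡ complChain zerosChain
  Unrolled-complChain-zerosChain = Unrolled-zeros-to-ones (reverse (L.map compl zerosChain-middle))
    complChain-zerosChain-shape (reverse-compl-NonConstant zerosChain-middle-NonConstant)

  zerosChain-shared : ∀ {a} → a ∈ zerosChain → a ∈ complChain zerosChain → a ≡ zeros ⊎ a ≡ ones
  zerosChain-shared a∈ a∈c = by-index (∈-applyUpTo⁻ prefixOnes a∈) (∈-map⁻ compl (reverse⁻ a∈c))
    where
    by-index : ∀ {a} → ∃ (λ j → j < suc N × a ≡ prefixOnes j) → ∃ (λ u → u ∈ zerosChain × a ≡ compl u) →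
               a ≡ zeros ⊎ a ≡ ones
    by-index (zero  , _ , refl) _ = inj₁ refl
    by-index (suc j , _ , refl) (u , u∈ , a≡) with ∈-applyUpTo⁻ prefixOnes u∈
    ... | zero   , _ , refl = inj₂ (trans a≡ compl-zeros)
    ... | suc j′ , _ , refl = ⊥-elim (true≢false (cong (λ y → bit y 0) a≡))

  GKSChain-NonConstant : ∀ (x : Bits N) → U₁ x ≡ [] → ∀ {a} → bit x a ≡ true →
                         All NonConstant (filterᵇ isGKSRep (gkChain x))
  GKSChain-NonConstant x u₁ bₐ = All.tabulate member
    where
    member : ∀ {u} → u ∈ filterᵇ isGKSRep (gkChain x) → NonConstant u
    member {u} u∈ with ∈-GKSChain {x = x} {u} u∈
    ... | s , refl , _ = τ^-NonConstant x u₁ bₐ s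

  GKSChain-through-zeros-or-ones : ∀ {c z} → GKSChain N c → Unrolled c z → zeros ∈ z ⊎ ones ∈ z → z ≡ zerosChain
  GKSChain-through-zeros-or-ones {c} {z} (x , u₁ , refl , _) un zo with zeros⊎has-1 x
  ... | inj₁ refl         = Unrolled-zerosChain (subst (λ l → Unrolled l z) GKSChain-zeros un) zo
  ... | inj₂ (a , bₐ)     = ⊥-elim (Unrolled-NonConstant (GKSChain-NonConstant x u₁ bₐ) un zo)

  complGKSChain-through-zeros-or-ones : ∀ {c w} → GKSChain N c → Unrolled (complChain c) w → zeros ∈ w ⊎ ones ∈ w →
                                      w ≡ complChain zerosChain
  complGKSChain-through-zeros-or-ones {c} {w} (x , u₁ , refl , _) un zo with zeros⊎has-1 x
  ... | inj₁ refl     = Unrolled-complChain-zerosChain (subst (λ l → Unrolled (complChain l) w) GKSChain-zeros un) zo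
  ... | inj₂ (a , bₐ) = ⊥-elim (Unrolled-NonConstant (reverse-compl-NonConstant (GKSChain-NonConstant x u₁ bₐ)) un zo)

  cbit-rot≡rot-compl : ∀ i j (y y′ : Bits N) → rot i y ≡ rot j (compl y′) →
                       ∀ {g} → g < N → cbit y (g + j + i * m) ≡ not (bit y′ g)
  cbit-rot≡rot-compl i j y y′ eq {g} g<N = begin
    cbit y (g + j + i * m)           ≡⟨ cbit-rot⁻¹ i y (g + j) ⟨
    cbit (rot i y) (g + j)           ≡⟨ cong (λ z → cbit z (g + j)) eq ⟩
    cbit (rot j (compl y′)) (g + j)  ≡⟨ cbit-rot j (compl y′) g ⟩
    cbit (compl y′) g                ≡⟨ cbit-compl y′ g ⟩
    not (cbit y′ g)                  ≡⟨ cong not (cbit-< y′ g<N) ⟩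
    not (bit y′ g)                   ∎
    where open ≡-Reasoning

  -- In the first chain a ⊆ b, in the complemented one a ⊇ b.
  shared-crossed : ∀ (x x′ : Bits N) i j {s r s′ r′} → s ≤ r → s′ < r′ →
                   rot i (τ^ s x) ≡ rot j (compl (τ^ s′ x′)) → rot i (τ^ r x) ≡ rot j (compl (τ^ r′ x′)) →
                   rot i (τ^ s x) ≡ rot i (τ^ r x)
  shared-crossed x x′ i j {s} {r} {s′} {r′} s≤r s′<r′ a≡ b≡ with τ^-fixed-or-sets x′ s′<r′
  ... | inj₁ fixed = trans a≡ (trans (cong (rot j ∘ compl) (sym fixed)) (sym b≡))
  ... | inj₂ (g , lu , set) = ⊥-elim (true≢false (trans (sym b-1) b-0))
    where
    open LeftmostUnmatched0 lu
    a-1 : cbit (τ^ s x) (g + j + i * m) ≡ true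
    a-1 = trans (cbit-rot≡rot-compl i j _ _ a≡ g<n) (cong not bit≡0)
    b-1 : cbit (τ^ r x) (g + j + i * m) ≡ true
    b-1 = τ^-monotone-≤ x s≤r a-1
    b-0 : cbit (τ^ r x) (g + j + i * m) ≡ false
    b-0 = trans (cbit-rot≡rot-compl i j _ _ b≡ g<n) (cong not set)

  pred-% : ∀ t → suc t % N ≢ 0 → t % N ≡ pred (suc t % N)
  pred-% t ≢0 with t % N ≟ m | m%n<n t N
  ... | yes t%N≡m | _    = ⊥-elim (≢0 (trans (suc-% t) (trans (cong (λ r → suc r % N) t%N≡m) (n%n≡0 N))))
  ... | no t%N≢m | t%N<N = sym (cong pred (trans (suc-% t) (m<n⇒m%n≡m (s<s (≤∧≢⇒< (≤-pred t%N<N) t%N≢m)))))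

  -- Starting with 1 excludes the wrap-around case suc t % N ≡ 0.
  τ^-newly-set-follows-1↻ : ∀ e (u : Bits N) t → bit u 0 ≡ true → cbit u (suc t) ≡ false →
                            cbit (τ^ e u) (suc t) ≡ true → cbit (τ^ e u) t ≡ true
  τ^-newly-set-follows-1↻ e u t b₀ u-0 v-1 with τ^-newly-set-follows-1 e u u-0 v-1
  ... | inj₁ d≡0 = ⊥-elim (true≢false (trans (sym b₀) (trans (cong (bit u) (sym d≡0)) u-0)))
  ... | inj₂ bₚ  = trans (cong (bit (τ^ e u)) (pred-% t d≢0)) bₚ
    where
    d≢0 : suc t % N ≢ 0
    d≢0 d≡0 = true≢false (trans (sym b₀) (trans (cong (bit u) (sym d≡0)) u-0))

  rot≢zeros⇒has-1 : ∀ i (y : Bits N) → rot i y ≢ zeros → ∃ λ t → cbit y t ≡ true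
  rot≢zeros⇒has-1 i y ≢zeros with zeros⊎has-1 y
  ... | inj₁ refl       = ⊥-elim (≢zeros (rot-zeros i))
  ... | inj₂ (t , b₁)   = t , trans (cbit-< y (bit-true⇒< y b₁)) b₁

  rot-compl≢ones⇒has-1 : ∀ j (y : Bits N) → rot j (compl y) ≢ ones → ∃ λ t → cbit y t ≡ true
  rot-compl≢ones⇒has-1 j y ≢ones with zeros⊎has-1 y
  ... | inj₁ refl       = ⊥-elim (≢ones (trans (cong (rot j) compl-zeros) (rot-ones j)))
  ... | inj₂ (t , b₁)   = t , trans (cbit-< y (bit-true⇒< y b₁)) b₁

  -- In both chains a ⊆ b. Along x′, τ sets bit g right after a 1, i.e. right after a 0
  -- of b; along x, the same bit is set right after a 1 of b.
  shared-aligned : ∀ (x x′ : Bits N) i j {s r s′ r′} → s < r → r′ < s′ →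
                    (∀ t → cbit (τ^ s x) t ≡ false → bit (τ^ s x) 0 ≡ true) →
                    (∀ t → cbit (τ^ r′ x′) t ≡ false → bit (τ^ r′ x′) 0 ≡ true) →
                    rot i (τ^ s x) ≡ rot j (compl (τ^ s′ x′)) → rot i (τ^ r x) ≡ rot j (compl (τ^ r′ x′)) →
                    rot i (τ^ s x) ≡ rot i (τ^ r x)
  shared-aligned x x′ i j {s} {r} {s′} {r′} s<r r′<s′ u-starts-1 q′-starts-1 a≡ b≡
    with τ^-fixed-or-sets x′ r′<s′
  ... | inj₁ fixed = trans a≡ (trans (cong (rot j ∘ compl) fixed) (sym b≡))
  ... | inj₂ (g , lu , set)
    with leftmostUnmatched0-after-1 (q′-starts-1 g (trans (cbit-< (τ^ r′ x′) (LeftmostUnmatched0.g<n lu)) (LeftmostUnmatched0.bit≡0 lu))) lu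
  ...   | g₀ , refl , q′-1 = ⊥-elim (true≢false (trans (sym v-1) v-0))
    where
    open LeftmostUnmatched0 lu
    M = g₀ + j + i * m
    split = τ^-split x (<⇒≤ s<r)
    u-0 : cbit (τ^ s x) (suc M) ≡ false
    u-0 = trans (cbit-rot≡rot-compl i j _ _ a≡ g<n) (cong not set)
    v-0 : cbit (τ^ r x) M ≡ false
    v-0 = trans (cbit-rot≡rot-compl i j _ _ b≡ (<-trans (n<1+n g₀) g<n)) (cong not q′-1)
    v-1 : cbit (τ^ r x) M ≡ true
    v-1 = subst (λ y → cbit y M ≡ true) (sym split)
            (τ^-newly-set-follows-1↻ (r ∸ s) (τ^ s x) M (u-starts-1 (suc M) u-0) u-0
              (subst (λ y → cbit y (suc M) ≡ true) split (trans (cbit-rot≡rot-compl i j _ _ b≡ g<n) (cong not bit≡0))))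

  shared-ordered : ∀ (x x′ : Bits N) i j {s r s′ r′} → s < r → Tri (s′ < r′) (s′ ≡ r′) (r′ < s′) →
                   isGKSRep (τ^ s x) ≡ true → isGKSRep (τ^ r′ x′) ≡ true →
                   rot i (τ^ s x) ≢ zeros → rot i (τ^ r x) ≢ ones →
                   rot i (τ^ s x) ≡ rot j (compl (τ^ s′ x′)) → rot i (τ^ r x) ≡ rot j (compl (τ^ r′ x′)) →
                   rot i (τ^ s x) ≡ rot i (τ^ r x)
  shared-ordered x x′ i j s<r (tri< s′<r′ _ _) _ _ _ _ a≡ b≡ = shared-crossed x x′ i j (<⇒≤ s<r) s′<r′ a≡ b≡
  shared-ordered x x′ i j s<r (tri≈ _ refl _)  _ _ _ _ a≡ b≡ = trans a≡ (sym b≡)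
  shared-ordered x x′ i j {s} {r′ = r′} s<r (tri> _ _ r′<s′) rep rep′ a≢0 b≢1 a≡ b≡ =
    shared-aligned x x′ i j s<r r′<s′
      (isGKSRep⇒first-1 (τ^ s x) rep (rot≢zeros⇒has-1 i (τ^ s x) a≢0))
      (isGKSRep⇒first-1 (τ^ r′ x′) rep′ (rot-compl≢ones⇒has-1 j (τ^ r′ x′) (b≢1 ∘ trans b≡)))
      a≡ b≡

  shared-≡ : ∀ {x x′ : Bits N} {i j z w} → RotatedOrbit x i z → RotatedComplOrbit x′ j w →
             ∀ {a b} → a ∈ z → a ∈ w → b ∈ z → b ∈ w →
             a ≢ zeros × a ≢ ones → b ≢ zeros × b ≢ ones → a ≡ b
  shared-≡ {x} {x′} {i} {j} orb orb′ a∈z a∈w b∈z b∈w (a≢0 , a≢1) (b≢0 , b≢1)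
    with orb a∈z | orb b∈z | orb′ a∈w | orb′ b∈w
  ... | s , refl , rep | r , refl , rep₂ | s′ , a≡ , rep′₁ | r′ , b≡ , rep′ = by-order (<-cmp s r)
    where
    by-order : Tri (s < r) (s ≡ r) (r < s) → rot i (τ^ s x) ≡ rot i (τ^ r x)
    by-order (tri< s<r _ _)  = shared-ordered x x′ i j s<r (<-cmp s′ r′) rep rep′ a≢0 b≢1 a≡ b≡
    by-order (tri≈ _ refl _) = refl
    by-order (tri> _ _ r<s)  = sym (shared-ordered x x′ i j r<s (<-cmp r′ s′) rep₂ rep′₁ b≢0 a≢1 b≡ a≡)

  almostOrthogonal : AlmostOrthogonal N
    (λ z → Σ (List (Bits N)) λ c → GKSChain N c × Unrolled c z)
    (λ w → Σ (List (Bits N)) λ c → GKSChain N c × Unrolled (complChain c) w)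
  almostOrthogonal z w (c , gc , uz) (c′ , gc′ , uw) = by-cases (z ≟ᶜ zerosChain ×-dec w ≟ᶜ complChain zerosChain)
    where
    _≟ᶜ_ : (l l′ : List (Bits N)) → Dec (l ≡ l′)
    _≟ᶜ_ = Listₚ.≡-dec (Vecₚ.≡-dec _≟ᵇ_)
    by-cases : Dec (z ≡ zerosChain × w ≡ complChain zerosChain) → _
    by-cases (yes (refl , refl)) = inj₂ (length-applyUpTo prefixOnes (suc N) , length-complChain , λ a → zerosChain-shared)
      where
      length-complChain : length (complChain zerosChain) ≡ suc N
      length-complChain = trans (length-reverse (L.map compl zerosChain))
                            (trans (length-map compl (zerosChain)) (length-applyUpTo prefixOnes (suc N)))
    by-cases (no ¬both) with Unrolled-GKSChain gc uz | Unrolled-complGKSChain gc′ uw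
    ... | x , i , orb | x′ , j , orb′ = inj₁ λ a b a∈z a∈w b∈z b∈w →
      shared-≡ {x} {x′} {i} {j} orb orb′ a∈z a∈w b∈z b∈w (proper a∈z a∈w) (proper b∈z b∈w)
      where
      proper : ∀ {a} → a ∈ z → a ∈ w → a ≢ zeros × a ≢ ones
      proper a∈z a∈w =
          (λ { refl → ¬both (GKSChain-through-zeros-or-ones gc uz (inj₁ a∈z) , complGKSChain-through-zeros-or-ones gc′ uw (inj₁ a∈w)) })
        , (λ { refl → ¬both (GKSChain-through-zeros-or-ones gc uz (inj₂ a∈z) , complGKSChain-through-zeros-or-ones gc′ uw (inj₂ a∈w)) })

RepChoice-self : ∀ {n} {c : List (Bits n)} → Linked Cover c → RepChoice c c
RepChoice-self l = Pointwise.refl (0 , refl) , l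

lemma13 : (n : ℕ) → Prime n →
    Σ (List (Bits n) → List (Bits n)) λ rep →
    Σ (List (Bits n) → List (Bits n)) λ repC →
      (∀ c → GKSChain n c → RepChoice c (rep c))
      × (∀ c → GKSChain n c → RepChoice (complChain c) (repC c))
      × AlmostOrthogonal n
          (λ z → Σ (List (Bits n)) λ c → GKSChain n c × Unrolled (rep c) z)
          (λ w → Σ (List (Bits n)) λ c → GKSChain n c × Unrolled (repC c) w)
-- Primality is only used to exclude n ≤ 1.
lemma13 zero          p = ⊥-elim (¬prime[0] p)
lemma13 (suc zero)    p = ⊥-elim (¬prime[1] p)
lemma13 (suc (suc k)) _ = id , complChain
  , (λ c gc → RepChoice-self (GKSChain-Linked c gc))
  , (λ c gc → RepChoice-self (complChain-Linked (GKSChain-Linked c gc)))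
  , almostOrthogonal
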